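{- There exists a gradient vector field on $M_7$ with respect to which there are exactly $21$ critical $2$-simplices, exactly one critical $1$-simplex, and exactly one critical $0$-simplex. Consequently, this gradient vector field is an optimal gradient vector field on $M_7$.
   Context: For $n \ge 1$, $M_n$ denotes the matching complex of the complete graph $K_n$: the abstract simplicial complex whose vertex set is the edge set of $K_n$ and whose simplices are the nonempty matchings of $K_n$ (sets of pairwise vertex-disjoint edges); a matching with $k+1$ edges is a $k$-simplex. A gradient vector field (discrete gradient in the sense of Forman's discrete Morse theory) on a simplicial complex $K$ is a collection $V$ of pairs $(\alpha, \beta)$ of simplices with $\alpha$ a codimension-one face of $\beta$, such that each simplex lies in at most one pair, and there is no nontrivial closed $V$-path, i.e., no sequence $\alpha_0, \beta_0, \alpha_1, \beta_1, \dots, \alpha_r$ of simplices with $r \ge 1$, $(\alpha_i,\beta_i) \in V$, $\alpha_{i+1} \ne \alpha_i$ a codimension-one face of $\beta_i$, and $\alpha_r = \alpha_0$. A simplex is critical with respect to $V$ if it belongs to no pair of $V$. A gradient vector field on $K$ is optimal if its number of critical simplices is the minimum possible over all gradient vector fields on $K$ (equivalently, here, the number of critical $i$-simplices attains the lower bounds forced by homology: for $M_7$, at least $21$ critical $2$-simplices, $1$ critical $1$-simplex and $1$ critical $0$-simplex). -}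

module Defs where

open import Data.Nat using (ℕ; zero; suc; _≤_)
open import Data.Fin using (Fin; _<_)
open import Data.Bool using (Bool; true; false)
open import Data.Vec using (Vec; lookup; map; sum)
open import Data.Fin.Subset using (∣_∣)
open import Data.List using (List; length)
open import Data.List.Membership.Propositional using (_∈_)
open import Data.List.Relation.Unary.Any using (Any)
open import Data.List.Relation.Unary.All using (All)
open import Data.List.Relation.Unary.Unique.Propositional using (Unique)
open import Data.Product using (Σ; ∃; ∃-syntax; _×_; _,_; proj₁; proj₂)
open import Data.Sum using (_⊎_)
open import Relation.Nullary using (¬_)
open import Relation.Binary.PropositionalEquality using (_≡_; _≢_)
open import Relation.Binary.Construct.Closure.Transitive using (TransClosure)
open import Function.Bundles using (_⇔_)

-- Sets of edges of the complete graph K_n on vertex set Fin n.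
-- The edge {i,j} with i < j is encoded by the entry (i , j) of an
-- n × n Boolean matrix; entries (i , j) with ¬ (i < j) must be false
-- (enforced in IsMatching).  So a simplex of M_n (a set of edges of K_n)
-- is an EdgeSet n.

EdgeSet : ℕ → Set
EdgeSet n = Vec (Vec Bool n) n

_∋ₑ_,_ : ∀ {n} → EdgeSet n → Fin n → Fin n → Set
S ∋ₑ i , j = lookup (lookup S i) j ≡ true

card : ∀ {n} → EdgeSet n → ℕ
card S = sum (map ∣_∣ S)

_⊆ₑ_ : ∀ {n} → EdgeSet n → EdgeSet n → Set
α ⊆ₑ β = ∀ i j → α ∋ₑ i , j → β ∋ₑ i , j

-- S is a simplex of M_n: a nonempty matching of K_n
-- (only genuine edges i < j, nonempty, pairwise vertex-disjoint edges).
IsMatching : ∀ {n} → EdgeSet n → Set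
IsMatching {n} S =
  (∀ i j → S ∋ₑ i , j → i < j)
  × (∃[ i ] ∃[ j ] (S ∋ₑ i , j))
  × (∀ i j k l → S ∋ₑ i , j → S ∋ₑ k , l → (i , j) ≢ (k , l) →
       (i ≢ k) × (i ≢ l) × (j ≢ k) × (j ≢ l))

IsSimplexDim : ∀ {n} → ℕ → EdgeSet n → Set
IsSimplexDim d S = IsMatching S × card S ≡ suc d

IsFacet : ∀ {n} → EdgeSet n → EdgeSet n → Set
IsFacet α β = IsMatching α × IsMatching β × α ⊆ₑ β × card β ≡ suc (card α)

VF : ℕ → Set
VF n = List (EdgeSet n × EdgeSet n)

InPair : ∀ {n} → EdgeSet n → EdgeSet n × EdgeSet n → Set
InPair σ p = σ ≡ proj₁ p ⊎ σ ≡ proj₂ p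

VStep : ∀ {n} → VF n → EdgeSet n → EdgeSet n → Set
VStep V α α' = ∃[ β ] ((α , β) ∈ V × IsFacet α' β × α' ≢ α)

IsGradient : ∀ {n} → VF n → Set
IsGradient {n} V =
  All (λ p → IsFacet (proj₁ p) (proj₂ p)) V
  × (∀ (σ : EdgeSet n) p q → p ∈ V → q ∈ V → InPair σ p → InPair σ q → p ≡ q)
  × (∀ (α : EdgeSet n) → ¬ TransClosure (VStep V) α α)

IsCritical : ∀ {n} → VF n → EdgeSet n → Set
IsCritical V σ = IsMatching σ × ¬ Any (InPair σ) V

IsCriticalDim : ∀ {n} → VF n → ℕ → EdgeSet n → Set
IsCriticalDim V d σ = IsSimplexDim d σ × ¬ Any (InPair σ) V

HasCard : ∀ {n} → (EdgeSet n → Set) → ℕ → Set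
HasCard {n} P k =
  ∃[ L ] (Unique L × (∀ (σ : EdgeSet n) → (σ ∈ L ⇔ P σ)) × length L ≡ k)

IsOptimal : ∀ {n} → VF n → Set
IsOptimal {n} V =
  IsGradient V ×
  (∀ (W : VF n) (k m : ℕ) → IsGradient W →
     HasCard (IsCritical V) k → HasCard (IsCritical W) m → k ≤ m)

-- The vector field V is given explicitly; that its pairs are facet–coface pairs, that no simplex
-- lies in two of them, that ranks strictly decrease along V-paths, and that it leaves 21 + 1 + 1
-- simplices critical are all checked by evaluation.
--
-- M₇ has 21 vertices, 105 edges and 105 triangles.  In a gradient vector field W the
-- partner of a paired vertex or triangle is a paired edge, and partnering is an involution, so at
-- most twice as many simplices are paired as there are paired edges.  Moreover W has a critical
-- edge: otherwise descending along V-paths of W from the vertices writes every 1-cocycle of M₇ as a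
-- coboundary, whereas the ℤ₃-valued cocycle φ₃ sums to 1 around a square of edges.  Hence at most
-- 2 · 104 simplices are paired and at least 231 − 208 = 23 are critical.

module Submission where

open import Defs
open import Data.Product using (∃-syntax; _×_)

open import Data.Nat as ℕ using (ℕ; zero; suc; _+_; _∸_; z≤n; s≤s)
open import Data.Nat.DivMod using (_mod_)
import Data.Nat.Properties as ℕ
open import Data.Fin as Fin using (Fin; #_)
import Data.Fin.Properties as Fin
open import Data.Bool using (true; false)
import Data.Bool.Properties as Bool
open import Data.Vec using (lookup; tabulate)
import Data.Vec.Properties as Vec
open import Data.List using (List; []; _∷_; [_]; length; _++_; map; filter; cartesianProduct; allFin)
  renaming (find to firstSuchThat)
open import Data.Maybe as Maybe using (Maybe; just; nothing; maybe)
import Data.Maybe.Properties as MaybeP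
import Data.List.Properties as List
open import Data.List.Membership.Propositional using (_∈_; _∉_; find; lose)
import Data.List.Relation.Unary.All.Properties as AllP
open import Data.List.Relation.Unary.All.Properties using (¬All⇒Any¬)
open import Data.List.Membership.Propositional.Properties
  using (∈-∃++; ∈-++⁻; ∈-++⁺ˡ; ∈-++⁺ʳ; ∈-filter⁺; ∈-filter⁻; ∈-map⁺; ∈-map⁻;
         ∈-cartesianProduct⁺; ∈-allFin)
open import Data.List.Relation.Binary.Subset.Propositional using (_⊆_)
open import Data.List.Relation.Unary.Any as Any using (Any; here; there)
open import Data.List.Relation.Unary.All as All using (All; []; _∷_)
open import Data.List.Relation.Unary.Unique.Propositional using (Unique)
import Data.List.Relation.Unary.Unique.Propositional.Properties as Unique
open import Data.List.Relation.Unary.AllPairs using ([]; _∷_)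
open import Data.Product as Σ using (_,_; proj₁; proj₂; Σ-syntax)
import Data.Product.Properties as Σ
open import Data.Sum as Sum using (_⊎_; inj₁; inj₂; [_,_]′)
open import Data.Empty using (⊥-elim)
open import Function using (_∘_; flip)
open import Function.Bundles using (_⇔_; mk⇔; Equivalence)
open import Relation.Nullary using (¬_; Dec; yes; no; does; contradiction)
open import Relation.Nullary.Decidable
  using (True; dec-true; dec-false; from-yes; ¬?; _×-dec_; _⊎-dec_; _→-dec_; map′)
open import Relation.Binary using (DecidableEquality)
open import Relation.Binary.PropositionalEquality
  using (_≡_; _≢_; refl; sym; trans; cong; cong₂; subst; subst₂; ≢-sym; isEquivalence)
open import Relation.Binary.Construct.Closure.Transitive as Plus using (TransClosure; _∷_; _∷ʳ_)
open import Induction.WellFounded as WF using (Acc; acc; WellFounded; module FixPoint)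
open import Algebra.Bundles using (AbelianGroup)
open import Level using (_⊔_; 0ℓ)

unique∧⊆⇒length≤ : ∀ {A : Set} {xs ys : List A} → Unique xs → xs ⊆ ys → length xs ℕ.≤ length ys
unique∧⊆⇒length≤ {xs = []} _ _ = z≤n
unique∧⊆⇒length≤ {xs = x ∷ xs} (x∉xs ∷ u) xs⊆ys with ∈-∃++ (xs⊆ys (here refl))
... | us , vs , refl = ℕ.≤-trans (s≤s (unique∧⊆⇒length≤ u drop-x)) (ℕ.≤-reflexive (sym (List.length-++-sucʳ us x vs)))
  where
  drop-x : xs ⊆ us ++ vs
  drop-x {y} y∈xs with ∈-++⁻ us (xs⊆ys (there y∈xs))
  ... | inj₁ y∈us = ∈-++⁺ˡ y∈us
  ... | inj₂ (here refl) = contradiction refl (All.lookup x∉xs y∈xs)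
  ... | inj₂ (there y∈vs) = ∈-++⁺ʳ us y∈vs

hasCard-functional : ∀ {n} {P : EdgeSet n → Set} {k m} → HasCard P k → HasCard P m → k ≡ m
hasCard-functional (L , uL , L⇔P , refl) (M , uM , M⇔P , refl) = ℕ.≤-antisym
  (unique∧⊆⇒length≤ uL λ {σ} σ∈L → Equivalence.from (M⇔P σ) (Equivalence.to (L⇔P σ) σ∈L))
  (unique∧⊆⇒length≤ uM λ {σ} σ∈M → Equivalence.from (L⇔P σ) (Equivalence.to (M⇔P σ) σ∈M))

length-filter+length-filter-¬ : ∀ {A : Set} {P : A → Set} (P? : ∀ x → Dec (P x)) xs →
  length (filter P? xs) + length (filter (¬? ∘ P?) xs) ≡ length xs
length-filter+length-filter-¬ P? [] = refl
length-filter+length-filter-¬ P? (x ∷ xs) with P? x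
... | yes _ = cong suc (length-filter+length-filter-¬ P? xs)
... | no _  = trans (ℕ.+-suc _ _) (cong suc (length-filter+length-filter-¬ P? xs))

-- Acyclic relations

module _ {A : Set} {R : A → A → Set} where

  decreasing⇒acyclic : (μ : A → ℕ) → (∀ {x y z} → R x y → R y z → μ y ℕ.< μ x) → ∀ x → ¬ TransClosure R x x
  decreasing⇒acyclic μ decr x cycle = ℕ.<-irrefl refl (descent cycle (proj₂ (first cycle)))
    where
    first : ∀ {x y} → TransClosure R x y → ∃[ z ] R x z
    first Plus.[ r ] = _ , r
    first (r ∷ _) = _ , r
    descent : ∀ {x y z} → TransClosure R x y → R y z → μ y ℕ.< μ x
    descent Plus.[ r ] r′ = decr r r′
    descent (r ∷ rs) r′ = ℕ.<-trans (descent rs r′) (decr r (proj₂ (first rs)))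

  acyclic⇒wellFounded : (U : List A) → (∀ {x y} → R x y → y ∈ U) → (∀ x → ¬ TransClosure R x x) →
                        WellFounded (flip R)
  acyclic⇒wellFounded U into-U acyclic x = acc λ r → search (length U) _ [] (into-U r) [] (λ ()) (λ ()) refl
    where
    search : ∀ n b (visited : List A) → b ∈ U → Unique visited → visited ⊆ U →
             (∀ {y} → y ∈ visited → TransClosure R y b) → length visited + n ≡ length U → Acc (flip R) b
    search n b visited b∈U unique visited⊆U reach-b = step n
      where
      b∉visited : All (b ≢_) visited
      b∉visited = All.tabulate λ y∈visited b≡y →
        acyclic b (subst (λ y → TransClosure R y b) (sym b≡y) (reach-b y∈visited))
      b∷visited⊆U : b ∷ visited ⊆ U
      b∷visited⊆U (here refl) = b∈U
      b∷visited⊆U (there y∈visited) = visited⊆U y∈visited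
      reach : ∀ {c} → R b c → ∀ {y} → y ∈ b ∷ visited → TransClosure R y c
      reach r (here refl) = Plus.[ r ]
      reach r (there y∈visited) = reach-b y∈visited ∷ʳ r
      step : ∀ n → length visited + n ≡ length U → Acc (flip R) b
      step zero fuel = ⊥-elim (ℕ.n≮n (length visited)
        (subst (suc (length visited) ℕ.≤_) (trans (sym fuel) (ℕ.+-identityʳ _))
          (unique∧⊆⇒length≤ (b∉visited ∷ unique) b∷visited⊆U)))
      step (suc n) fuel = acc λ r → search n _ (b ∷ visited) (into-U r) (b∉visited ∷ unique) b∷visited⊆U (reach r)
        (trans (sym (ℕ.+-suc (length visited) n)) fuel)

module _ {g ℓ} (G : AbelianGroup g ℓ) where
  open AbelianGroup G renaming (sym to ≈-sym; trans to ≈-trans)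
  open import Algebra.Properties.AbelianGroup G using (⁻¹-anti-homo‿-; inverseˡ-unique)
  open import Relation.Binary.Reasoning.Setoid setoid

  -‿telescope : ∀ x y z → (y - x) ∙ (z - y) ≈ z - x
  -‿telescope x y z = begin
    (y - x) ∙ (z - y)          ≈⟨ comm (y - x) (z - y) ⟩
    (z - y) ∙ (y - x)          ≈⟨ assoc z (y ⁻¹) (y - x) ⟩
    z ∙ (y ⁻¹ ∙ (y ∙ x ⁻¹))    ≈⟨ ∙-congˡ (≈-sym (assoc (y ⁻¹) y (x ⁻¹))) ⟩
    z ∙ ((y ⁻¹ ∙ y) ∙ x ⁻¹)    ≈⟨ ∙-congˡ (∙-congʳ (inverseˡ y)) ⟩
    z ∙ (ε ∙ x ⁻¹)             ≈⟨ ∙-congˡ (identityˡ (x ⁻¹)) ⟩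
    z - x                      ∎

  x≈y-z⇒z≈y-x : ∀ {x y z} → x ≈ y - z → z ≈ y - x
  x≈y-z⇒z≈y-x {x} {y} {z} x≈y-z = ≈-sym (begin
    y - x              ≈⟨ ∙-congˡ (⁻¹-cong x≈y-z) ⟩
    y ∙ (y - z) ⁻¹     ≈⟨ ∙-congˡ (⁻¹-anti-homo‿- y z) ⟩
    y ∙ (z - y)        ≈⟨ comm y (z - y) ⟩
    (z ∙ y ⁻¹) ∙ y     ≈⟨ assoc z (y ⁻¹) y ⟩
    z ∙ (y ⁻¹ ∙ y)     ≈⟨ ∙-congˡ (inverseˡ y) ⟩
    z ∙ ε              ≈⟨ identityʳ z ⟩
    z                  ∎)

  triangle-potential : ∀ {p q r u v w} → u ∙ v ∙ w ≈ ε → v ≈ r - q → w ≈ p - r → u ≈ q - p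
  triangle-potential {p} {q} {r} {u} {v} {w} closed v≈ w≈ = begin
    u                      ≈⟨ inverseˡ-unique u (v ∙ w) (≈-trans (≈-sym (assoc u v w)) closed) ⟩
    (v ∙ w) ⁻¹             ≈⟨ ⁻¹-cong (∙-cong v≈ w≈) ⟩
    ((r - q) ∙ (p - r)) ⁻¹ ≈⟨ ⁻¹-cong (-‿telescope q r p) ⟩
    (p - q) ⁻¹             ≈⟨ ⁻¹-anti-homo‿- p q ⟩
    q - p                  ∎

  square-potential : ∀ {p q r s u v w t} → u ≈ q - p → v ≈ r - q → w ≈ s - r → t ≈ p - s → u ∙ v ∙ w ∙ t ≈ ε
  square-potential {p} {q} {r} {s} {u} {v} {w} {t} u≈ v≈ w≈ t≈ = begin
    u ∙ v ∙ w ∙ t                              ≈⟨ ∙-cong (∙-cong (∙-cong u≈ v≈) w≈) t≈ ⟩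
    (q - p) ∙ (r - q) ∙ (s - r) ∙ (p - s)      ≈⟨ ∙-congʳ (∙-congʳ (-‿telescope p q r)) ⟩
    (r - p) ∙ (s - r) ∙ (p - s)                ≈⟨ ∙-congʳ (-‿telescope p r s) ⟩
    (s - p) ∙ (p - s)                          ≈⟨ -‿telescope p s p ⟩
    p - p                                      ≈⟨ inverseʳ p ⟩
    ε                                          ∎

_≟ˢ_ : ∀ {n} → DecidableEquality (EdgeSet n)
_≟ˢ_ = Vec.≡-dec (Vec.≡-dec Bool._≟_)

Paired : ∀ {n} → VF n → EdgeSet n → Set
Paired V σ = Any (InPair σ) V

paired? : ∀ {n} (V : VF n) σ → Dec (Paired V σ)
paired? V σ = Any.any? (λ p → (σ ≟ˢ proj₁ p) ⊎-dec (σ ≟ˢ proj₂ p)) V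

PairedWith : ∀ {n} → VF n → EdgeSet n → EdgeSet n → Set
PairedWith V σ τ = (σ , τ) ∈ V ⊎ (τ , σ) ∈ V

pairedWith⇒paired : ∀ {n} {V : VF n} {σ τ} → PairedWith V σ τ → Paired V σ
pairedWith⇒paired (inj₁ στ∈V) = Any.map (λ { refl → inj₁ refl }) στ∈V
pairedWith⇒paired (inj₂ τσ∈V) = Any.map (λ { refl → inj₂ refl }) τσ∈V

pairedWith-sym : ∀ {n} {V : VF n} {σ τ} → PairedWith V σ τ → PairedWith V τ σ
pairedWith-sym = Sum.swap

partner : ∀ {n} → VF n → EdgeSet n → EdgeSet n
partner [] σ = σ
partner ((α , β) ∷ V) σ with σ ≟ˢ α | σ ≟ˢ β
... | yes _ | _     = β
... | no _  | yes _ = α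
... | no _  | no _  = partner V σ

partner-pairedWith : ∀ {n} {V : VF n} {σ} → Paired V σ → PairedWith V σ (partner V σ)
partner-pairedWith {V = (α , β) ∷ V} {σ} σ-paired with σ ≟ˢ α | σ ≟ˢ β
... | yes refl | _        = inj₁ (here refl)
... | no _     | yes refl = inj₂ (here refl)
... | no σ≢α   | no σ≢β with σ-paired
...   | here (inj₁ σ≡α) = contradiction σ≡α σ≢α
...   | here (inj₂ σ≡β) = contradiction σ≡β σ≢β
...   | there σ-paired′ = Sum.map there there (partner-pairedWith σ-paired′)

module _ {n} {W : VF n} (gradient : IsGradient W) where

  pair-unique : ∀ {σ p q} → p ∈ W → q ∈ W → InPair σ p → InPair σ q → p ≡ q
  pair-unique = proj₁ (proj₂ gradient) _ _ _

  pairedWith-facet : ∀ {σ τ} → PairedWith W σ τ → IsFacet σ τ ⊎ IsFacet τ σ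
  pairedWith-facet (inj₁ στ∈W) = inj₁ (All.lookup (proj₁ gradient) στ∈W)
  pairedWith-facet (inj₂ τσ∈W) = inj₂ (All.lookup (proj₁ gradient) τσ∈W)

  pairedWith-functional : ∀ {σ τ τ′} → PairedWith W σ τ → PairedWith W σ τ′ → τ ≡ τ′
  pairedWith-functional (inj₁ m) (inj₁ m′) = cong proj₂ (pair-unique m m′ (inj₁ refl) (inj₁ refl))
  pairedWith-functional (inj₁ m) (inj₂ m′) with refl ← pair-unique m m′ (inj₁ refl) (inj₂ refl) = refl
  pairedWith-functional (inj₂ m) (inj₁ m′) with refl ← pair-unique m m′ (inj₂ refl) (inj₁ refl) = refl
  pairedWith-functional (inj₂ m) (inj₂ m′) = cong proj₁ (pair-unique m m′ (inj₂ refl) (inj₂ refl))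

  partner-involutive : ∀ {σ} → Paired W σ → partner W (partner W σ) ≡ σ
  partner-involutive σ-paired = pairedWith-functional
    (partner-pairedWith (pairedWith⇒paired (pairedWith-sym (partner-pairedWith σ-paired))))
    (pairedWith-sym (partner-pairedWith σ-paired))

Edge : Set
Edge = Fin 7 × Fin 7

infix 6 _─_
_─_ : (i j : ℕ) {i<7 : True (i ℕ.<? 7)} {j<7 : True (j ℕ.<? 7)} → Edge
(i ─ j) {i<7} {j<7} = (# i) {m<n = i<7} , (# j) {m<n = j<7}

_∋_ : EdgeSet 7 → Edge → Set
S ∋ e = S ∋ₑ proj₁ e , proj₂ e

Proper : Edge → Set
Proper (i , j) = i Fin.< j

Disjoint : Edge → Edge → Set
Disjoint (i , j) (k , l) = i ≢ k × i ≢ l × j ≢ k × j ≢ l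

_≟ₑ_ : DecidableEquality Edge
_≟ₑ_ = Σ.≡-dec Fin._≟_ Fin._≟_

open import Data.List.Membership.DecPropositional _≟ₑ_ using (_∈?_)
open import Data.List.Relation.Unary.Unique.DecPropositional _≟ₑ_ using (unique?)

disjoint? : ∀ a b → Dec (Disjoint a b)
disjoint? (i , j) (k , l) = ¬? (i Fin.≟ k) ×-dec ¬? (i Fin.≟ l) ×-dec ¬? (j Fin.≟ k) ×-dec ¬? (j Fin.≟ l)

-- Computed lists are kept opaque so that unification never evaluates them; only the decision
-- procedures that check facts about them unfold them.
opaque
  edges : List Edge
  edges = filter (λ e → proj₁ e Fin.<? proj₂ e) (cartesianProduct (allFin 7) (allFin 7))

  proper⇒∈edges : ∀ {e} → Proper e → e ∈ edges
  proper⇒∈edges {i , j} i<j =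
    ∈-filter⁺ (λ e → proj₁ e Fin.<? proj₂ e) (∈-cartesianProduct⁺ (∈-allFin i) (∈-allFin j)) i<j

  edges-unique : Unique edges
  edges-unique = from-yes (unique? edges)

-- Simplices are handled as lists of edges; ⟦_⟧ and code translate to and from the Boolean
-- matrices of Defs.
Code : Set
Code = List Edge

_≟ᶜ_ : DecidableEquality Code
_≟ᶜ_ = List.≡-dec _≟ₑ_

open import Data.List.Membership.DecPropositional _≟ᶜ_ using () renaming (_∈?_ to _∈ᶜ?_)
open import Data.List.Relation.Unary.Unique.DecPropositional _≟ᶜ_ using () renaming (unique? to uniqueᶜ?)

_∋?_ : ∀ S e → Dec (S ∋ e)
S ∋? e = lookup (lookup S (proj₁ e)) (proj₂ e) Bool.≟ true

code : EdgeSet 7 → Code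
code S = filter (S ∋?_) edges

opaque
  ⟦_⟧ : Code → EdgeSet 7
  ⟦ c ⟧ = tabulate λ i → tabulate λ j → does ((i , j) ∈? c)

  lookup-⟦⟧ : ∀ c i j → lookup (lookup ⟦ c ⟧ i) j ≡ does ((i , j) ∈? c)
  lookup-⟦⟧ c i j = trans
    (cong (λ row → lookup row j) (Vec.lookup∘tabulate (λ i → tabulate λ j → does ((i , j) ∈? c)) i))
    (Vec.lookup∘tabulate (λ j → does ((i , j) ∈? c)) j)

  ⟦⟧-≡ : ∀ {c S} → (∀ i j → does ((i , j) ∈? c) ≡ lookup (lookup S i) j) → ⟦ c ⟧ ≡ S
  ⟦⟧-≡ {S = S} entries = trans
    (Vec.tabulate-cong λ i → trans (Vec.tabulate-cong (entries i)) (Vec.tabulate∘lookup (lookup S i)))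
    (Vec.tabulate∘lookup S)

∈⇒∋ : ∀ {c e} → e ∈ c → ⟦ c ⟧ ∋ e
∈⇒∋ {c} {i , j} e∈c = trans (lookup-⟦⟧ c i j) (dec-true ((i , j) ∈? c) e∈c)

∋⇒∈ : ∀ {c e} → ⟦ c ⟧ ∋ e → e ∈ c
∋⇒∈ {c} {i , j} c∋e with (i , j) ∈? c | lookup-⟦⟧ c i j
... | yes e∈c | _  = e∈c
... | no _    | eq = contradiction (trans (sym eq) c∋e) λ ()

⟦⟧-mono⁻ : ∀ {c d} → ⟦ c ⟧ ⊆ₑ ⟦ d ⟧ → c ⊆ d
⟦⟧-mono⁻ ⟦c⟧⊆⟦d⟧ {i , j} = ∋⇒∈ ∘ ⟦c⟧⊆⟦d⟧ i j ∘ ∈⇒∋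

code-∋ : ∀ {S e} → e ∈ code S → S ∋ e
code-∋ {S} e∈code = proj₂ (∈-filter⁻ (S ∋?_) {xs = edges} e∈code)

∋⇒∈code : ∀ {S e} → Proper e → S ∋ e → e ∈ code S
∋⇒∈code {S} proper S∋e = ∈-filter⁺ (S ∋?_) (proper⇒∈edges proper) S∋e

code-unique : ∀ S → Unique (code S)
code-unique S = Unique.filter⁺ (S ∋?_) edges-unique

⟦code⟧ : ∀ {S} → IsMatching S → ⟦ code S ⟧ ≡ S
⟦code⟧ {S} (proper , _) = ⟦⟧-≡ entry
  where
  entry : ∀ i j → does ((i , j) ∈? code S) ≡ lookup (lookup S i) j
  entry i j with lookup (lookup S i) j in S∋e
  ... | true  = dec-true (_ ∈? code S) (∋⇒∈code {S} (proper i j S∋e) S∋e)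
  ... | false = dec-false (_ ∈? code S) λ e∈code → contradiction (trans (sym (code-∋ {S} e∈code)) S∋e) λ ()

WellFormed : Code → Set
WellFormed c = All Proper c × All (λ a → All (λ b → a ≢ b → Disjoint a b) c) c × 0 ℕ.< length c

wellFormed? : ∀ c → Dec (WellFormed c)
wellFormed? c = All.all? (λ e → proj₁ e Fin.<? proj₂ e) c
  ×-dec All.all? (λ a → All.all? (λ b → ¬? (a ≟ₑ b) →-dec disjoint? a b) c) c
  ×-dec 0 ℕ.<? length c

wellFormed⇒matching : ∀ {c} → WellFormed c → IsMatching ⟦ c ⟧
wellFormed⇒matching {c} (proper , disjoint , nonempty) = proper′ , nonempty′ c nonempty , disjoint′
  where
  proper′ : ∀ i j → ⟦ c ⟧ ∋ₑ i , j → i Fin.< j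
  proper′ i j c∋ij = All.lookup proper (∋⇒∈ c∋ij)
  nonempty′ : ∀ d → 0 ℕ.< length d → ∃[ i ] ∃[ j ] (⟦ d ⟧ ∋ₑ i , j)
  nonempty′ ((i , j) ∷ _) _ = i , j , ∈⇒∋ (here refl)
  disjoint′ : ∀ i j k l → ⟦ c ⟧ ∋ₑ i , j → ⟦ c ⟧ ∋ₑ k , l → (i , j) ≢ (k , l) → Disjoint (i , j) (k , l)
  disjoint′ i j k l c∋ij c∋kl = All.lookup (All.lookup disjoint (∋⇒∈ c∋ij)) (∋⇒∈ c∋kl)

extendBy : Edge → List Code → List Code
extendBy e ms = ms ++ map (e ∷_) (filter (All.all? (disjoint? e)) ms)

opaque
  matchingsIn : List Edge → List Code
  matchingsIn [] = [ [] ]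
  matchingsIn (e ∷ es) = extendBy e (matchingsIn es)

  filter∈matchingsIn : ∀ {P : Edge → Set} (P? : ∀ e → Dec (P e)) {es} → Unique es →
    (∀ {a b} → a ∈ filter P? es → b ∈ filter P? es → a ≢ b → Disjoint a b) → filter P? es ∈ matchingsIn es
  filter∈matchingsIn P? {[]} _ _ = here refl
  filter∈matchingsIn P? {e ∷ es} (e∉es ∷ unique) disjoint with P? e
  ... | no _  = ∈-++⁺ˡ (filter∈matchingsIn P? unique disjoint)
  ... | yes _ = ∈-++⁺ʳ (matchingsIn es) (∈-map⁺ (e ∷_) (∈-filter⁺ (All.all? (disjoint? e))
    (filter∈matchingsIn P? unique λ a∈ b∈ → disjoint (there a∈) (there b∈))
    (All.tabulate λ b∈ → disjoint (here refl) (there b∈) (All.lookup e∉es (proj₁ (∈-filter⁻ P? b∈))))))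

matchings : List Code
matchings = matchingsIn edges

hasLength? : ∀ n (c : Code) → Dec (length c ≡ n)
hasLength? n c = length c ℕ.≟ n

simplicesOfDim : ℕ → List Code
simplicesOfDim d = filter (hasLength? (suc d)) matchings

simplices : List Code
simplices = simplicesOfDim 0 ++ simplicesOfDim 1 ++ simplicesOfDim 2

opaque
  unfolding matchingsIn edges ⟦_⟧

  matchings-have-at-most-three-edges : All (λ c → length c ℕ.≤ 3) matchings
  matchings-have-at-most-three-edges = from-yes (All.all? (λ c → length c ℕ.≤? 3) matchings)

  simplices-faithful : All (λ c → WellFormed c × card ⟦ c ⟧ ≡ length c × code ⟦ c ⟧ ≡ c) simplices
  simplices-faithful = from-yes (All.all?
    (λ c → wellFormed? c ×-dec card ⟦ c ⟧ ℕ.≟ length c ×-dec code ⟦ c ⟧ ≟ᶜ c) simplices)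

module _ {c : Code} (c∈simplices : c ∈ simplices) where

  simplex-wellFormed : WellFormed c
  simplex-wellFormed = proj₁ (All.lookup simplices-faithful c∈simplices)

  simplex-card : card ⟦ c ⟧ ≡ length c
  simplex-card = proj₁ (proj₂ (All.lookup simplices-faithful c∈simplices))

  code-⟦⟧ : code ⟦ c ⟧ ≡ c
  code-⟦⟧ = proj₂ (proj₂ (All.lookup simplices-faithful c∈simplices))

  simplex-matching : IsMatching ⟦ c ⟧
  simplex-matching = wellFormed⇒matching simplex-wellFormed

  simplex-unique : Unique c
  simplex-unique = subst Unique code-⟦⟧ (code-unique ⟦ c ⟧)

⟦⟧-injective : ∀ {c d} → c ∈ simplices → d ∈ simplices → ⟦ c ⟧ ≡ ⟦ d ⟧ → c ≡ d
⟦⟧-injective c∈ d∈ eq = trans (sym (code-⟦⟧ c∈)) (trans (cong code eq) (code-⟦⟧ d∈))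

∈matchings⇒∈simplices : ∀ {c} → c ∈ matchings → 0 ℕ.< length c → c ∈ simplices
∈matchings⇒∈simplices {_ ∷ []} m _ = ∈-++⁺ˡ (∈-filter⁺ (hasLength? 1) m refl)
∈matchings⇒∈simplices {_ ∷ _ ∷ []} m _ =
  ∈-++⁺ʳ (simplicesOfDim 0) (∈-++⁺ˡ (∈-filter⁺ (hasLength? 2) m refl))
∈matchings⇒∈simplices {_ ∷ _ ∷ _ ∷ []} m _ =
  ∈-++⁺ʳ (simplicesOfDim 0) (∈-++⁺ʳ (simplicesOfDim 1) (∈-filter⁺ (hasLength? 3) m refl))
∈matchings⇒∈simplices {_ ∷ _ ∷ _ ∷ _ ∷ _} m _ =
  contradiction (All.lookup matchings-have-at-most-three-edges m) λ { (s≤s (s≤s (s≤s ()))) }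

∈simplicesOfDim⇒∈simplices : ∀ {c d} → c ∈ simplicesOfDim d → c ∈ simplices
∈simplicesOfDim⇒∈simplices {c} {d} c∈ with ∈-filter⁻ (hasLength? (suc d)) c∈
... | c∈matchings , length≡ =
  ∈matchings⇒∈simplices c∈matchings (ℕ.≤-trans (s≤s z≤n) (ℕ.≤-reflexive (sym length≡)))

∈simplicesOfDim⇒dim : ∀ {c d} → c ∈ simplicesOfDim d → IsSimplexDim d ⟦ c ⟧
∈simplicesOfDim⇒dim {c} {d} c∈ = simplex-matching c∈simplices ,
  trans (simplex-card c∈simplices) (proj₂ (∈-filter⁻ (hasLength? (suc d)) {xs = matchings} c∈))
  where
  c∈simplices : c ∈ simplices
  c∈simplices = ∈simplicesOfDim⇒∈simplices c∈

module _ {S : EdgeSet 7} (matching : IsMatching S) where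

  code∈matchings : code S ∈ matchings
  code∈matchings = filter∈matchingsIn (S ∋?_) edges-unique λ a∈ b∈ →
    proj₂ (proj₂ matching) _ _ _ _ (code-∋ {S} a∈) (code-∋ {S} b∈)

  code∈simplices : code S ∈ simplices
  code∈simplices with proj₁ (proj₂ matching)
  ... | i , j , S∋ij = ∈matchings⇒∈simplices code∈matchings
    (List.filter-some (S ∋?_) (Any.map (λ { refl → S∋ij }) (proper⇒∈edges (proj₁ matching i j S∋ij))))

  length-code : length (code S) ≡ card S
  length-code = trans (sym (simplex-card code∈simplices)) (cong card (⟦code⟧ {S} matching))

  code∈simplicesOfDim : ∀ {d} → card S ≡ suc d → code S ∈ simplicesOfDim d
  code∈simplicesOfDim card≡ = ∈-filter⁺ (hasLength? (suc _)) code∈matchings (trans length-code card≡)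

∋⇒wellFormed : ∀ {S c} → IsMatching S → All (S ∋_) c → 0 ℕ.< length c → WellFormed c
∋⇒wellFormed (proper , _ , disjoint) S∋c nonempty =
  All.map (λ {e} → proper (proj₁ e) (proj₂ e)) S∋c ,
  All.map (λ S∋a → All.map (λ S∋b → disjoint _ _ _ _ S∋a S∋b) S∋c) S∋c ,
  nonempty

card-⟦⟧ : ∀ {c} → WellFormed c → Unique c → card ⟦ c ⟧ ≡ length c
card-⟦⟧ {c} wellFormed unique = trans (sym (length-code {⟦ c ⟧} (wellFormed⇒matching wellFormed)))
  (ℕ.≤-antisym (unique∧⊆⇒length≤ (code-unique ⟦ c ⟧) (∋⇒∈ ∘ code-∋ {⟦ c ⟧}))
               (unique∧⊆⇒length≤ unique λ e∈c →
                 ∋⇒∈code {⟦ c ⟧} (All.lookup (proj₁ wellFormed) e∈c) (∈⇒∋ e∈c)))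

module _ {S : EdgeSet 7} (matching : IsMatching S) where

  ∋-proper : ∀ {e} → S ∋ e → Proper e
  ∋-proper {e} = proj₁ matching (proj₁ e) (proj₂ e)

  matching-∋⇒∈code : ∀ {e} → S ∋ e → e ∈ code S
  matching-∋⇒∈code S∋e = ∋⇒∈code {S} (∋-proper S∋e) S∋e

  unique∧∋⇒length≤card : ∀ {c} → Unique c → All (S ∋_) c → length c ℕ.≤ card S
  unique∧∋⇒length≤card unique S∋c = ℕ.≤-trans
    (unique∧⊆⇒length≤ unique (matching-∋⇒∈code ∘ All.lookup S∋c))
    (ℕ.≤-reflexive (length-code {S} matching))

  ∃-outside : ∀ c → length c ℕ.< card S → ∃[ e ] S ∋ e × e ∉ c
  ∃-outside c shorter with All.all? (_∈? c) (code S)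
  ... | yes code⊆c = contradiction
        (unique∧⊆⇒length≤ (code-unique S) (All.lookup code⊆c))
        (ℕ.<⇒≱ (subst (length c ℕ.<_) (sym (length-code {S} matching)) shorter))
  ... | no ¬code⊆c with find (¬All⇒Any¬ (_∈? c) (code S) ¬code⊆c)
  ...   | e , e∈code , e∉c = e , code-∋ {S} e∈code , e∉c

  facet-⟦⟧ : ∀ {c} → All (S ∋_) c → Unique c → 0 ℕ.< length c → card S ≡ suc (length c) → IsFacet ⟦ c ⟧ S
  facet-⟦⟧ {c} S∋c unique nonempty card≡ =
    wellFormed⇒matching wellFormed , matching , (λ i j → All.lookup S∋c ∘ ∋⇒∈) ,
    trans card≡ (cong suc (sym (card-⟦⟧ wellFormed unique)))
    where
    wellFormed : WellFormed c
    wellFormed = ∋⇒wellFormed {S} matching S∋c nonempty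

facet⇒dim : ∀ {σ τ : EdgeSet 7} {d} → IsFacet σ τ → card τ ≡ suc (suc d) → IsSimplexDim d σ
facet⇒dim (σ-matching , _ , _ , card≡) card-τ = σ-matching , ℕ.suc-injective (trans (sym card≡) card-τ)

coface⇒dim : ∀ {σ τ : EdgeSet 7} {d} → IsFacet σ τ → card σ ≡ suc d → IsSimplexDim (suc d) τ
coface⇒dim (_ , τ-matching , _ , card≡) card-σ = τ-matching , trans card≡ (cong suc card-σ)

vertex-shape : ∀ {α : EdgeSet 7} → IsSimplexDim 0 α → ∃[ x ] α ≡ ⟦ [ x ] ⟧
vertex-shape {α} (matching , card≡1) with code α | ⟦code⟧ {α} matching | length-code {α} matching
... | x ∷ []      | ⟦x⟧≡α | _   = x , sym ⟦x⟧≡α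
... | []          | _     | len = contradiction (trans len card≡1) λ ()
... | _ ∷ _ ∷ _  | _     | len = contradiction (trans len card≡1) λ ()

edge-has-two-ends : ∀ {β : EdgeSet 7} {x w w′} → IsSimplexDim 1 β →
                    β ∋ x → β ∋ w → β ∋ w′ → w ≢ x → w′ ≢ x → w′ ≡ w
edge-has-two-ends {β} {x} {w} {w′} (matching , card≡2) β∋x β∋w β∋w′ w≢x w′≢x with w′ ≟ₑ w
... | yes w′≡w = w′≡w
... | no w′≢w = contradiction
  (unique∧∋⇒length≤card {β} matching
    ((≢-sym w≢x ∷ ≢-sym w′≢x ∷ []) ∷ (≢-sym w′≢w ∷ []) ∷ [] ∷ []) (β∋x ∷ β∋w ∷ β∋w′ ∷ []))
  (subst (λ n → ¬ 3 ℕ.≤ n) (sym card≡2) λ { (s≤s (s≤s ())) })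

-- An optimal gradient vector field on M₇

-- Each entry (r , α , β) pairs the simplex α with its coface β; the ranks r
-- certify acyclicity, as they strictly decrease along every V-path.
opaque
  rankedPairs : List (ℕ × Code × Code)
  rankedPairs =
    (2 , [ 0 ─ 1 ] , 0 ─ 1 ∷ 2 ─ 6 ∷ [])
    ∷ (4 , [ 0 ─ 2 ] , 0 ─ 2 ∷ 4 ─ 6 ∷ [])
    ∷ (2 , [ 0 ─ 3 ] , 0 ─ 3 ∷ 2 ─ 6 ∷ [])
    ∷ (5 , [ 0 ─ 4 ] , 0 ─ 4 ∷ 2 ─ 5 ∷ [])
    ∷ (5 , [ 0 ─ 5 ] , 0 ─ 5 ∷ 2 ─ 3 ∷ [])
    ∷ (7 , [ 0 ─ 6 ] , 0 ─ 6 ∷ 1 ─ 5 ∷ [])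
    ∷ (0 , [ 1 ─ 2 ] , 1 ─ 2 ∷ 3 ─ 6 ∷ [])
    ∷ (2 , [ 1 ─ 3 ] , 1 ─ 3 ∷ 2 ─ 6 ∷ [])
    ∷ (8 , [ 1 ─ 4 ] , 0 ─ 6 ∷ 1 ─ 4 ∷ [])
    ∷ (6 , [ 1 ─ 5 ] , 0 ─ 4 ∷ 1 ─ 5 ∷ [])
    ∷ (3 , [ 1 ─ 6 ] , 0 ─ 3 ∷ 1 ─ 6 ∷ [])
    ∷ (4 , [ 2 ─ 3 ] , 1 ─ 6 ∷ 2 ─ 3 ∷ [])
    ∷ (0 , [ 2 ─ 4 ] , 2 ─ 4 ∷ 3 ─ 6 ∷ [])
    ∷ (4 , [ 2 ─ 5 ] , 2 ─ 5 ∷ 4 ─ 6 ∷ [])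
    ∷ (1 , [ 2 ─ 6 ] , 2 ─ 6 ∷ 4 ─ 5 ∷ [])
    ∷ (8 , [ 3 ─ 4 ] , 0 ─ 6 ∷ 3 ─ 4 ∷ [])
    ∷ (4 , [ 3 ─ 5 ] , 1 ─ 6 ∷ 3 ─ 5 ∷ [])
    ∷ (0 , [ 4 ─ 5 ] , 3 ─ 6 ∷ 4 ─ 5 ∷ [])
    ∷ (3 , [ 4 ─ 6 ] , 1 ─ 3 ∷ 4 ─ 6 ∷ [])
    ∷ (9 , [ 5 ─ 6 ] , 1 ─ 4 ∷ 5 ─ 6 ∷ [])
    ∷ (3 , 0 ─ 1 ∷ 2 ─ 3 ∷ [] , 0 ─ 1 ∷ 2 ─ 3 ∷ 4 ─ 5 ∷ [])
    ∷ (2 , 0 ─ 1 ∷ 2 ─ 4 ∷ [] , 0 ─ 1 ∷ 2 ─ 4 ∷ 3 ─ 6 ∷ [])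
    ∷ (10 , 0 ─ 1 ∷ 2 ─ 5 ∷ [] , 0 ─ 1 ∷ 2 ─ 5 ∷ 3 ─ 6 ∷ [])
    ∷ (17 , 0 ─ 1 ∷ 3 ─ 4 ∷ [] , 0 ─ 1 ∷ 2 ─ 6 ∷ 3 ─ 4 ∷ [])
    ∷ (12 , 0 ─ 1 ∷ 3 ─ 5 ∷ [] , 0 ─ 1 ∷ 3 ─ 5 ∷ 4 ─ 6 ∷ [])
    ∷ (1 , 0 ─ 1 ∷ 3 ─ 6 ∷ [] , 0 ─ 1 ∷ 3 ─ 6 ∷ 4 ─ 5 ∷ [])
    ∷ (0 , 0 ─ 1 ∷ 4 ─ 5 ∷ [] , 0 ─ 1 ∷ 2 ─ 6 ∷ 4 ─ 5 ∷ [])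
    ∷ (11 , 0 ─ 1 ∷ 4 ─ 6 ∷ [] , 0 ─ 1 ∷ 2 ─ 5 ∷ 4 ─ 6 ∷ [])
    ∷ (30 , 0 ─ 1 ∷ 5 ─ 6 ∷ [] , 0 ─ 1 ∷ 3 ─ 4 ∷ 5 ─ 6 ∷ [])
    ∷ (0 , 0 ─ 2 ∷ 1 ─ 3 ∷ [] , 0 ─ 2 ∷ 1 ─ 3 ∷ 4 ─ 6 ∷ [])
    ∷ (24 , 0 ─ 2 ∷ 1 ─ 4 ∷ [] , 0 ─ 2 ∷ 1 ─ 4 ∷ 3 ─ 5 ∷ [])
    ∷ (14 , 0 ─ 2 ∷ 1 ─ 5 ∷ [] , 0 ─ 2 ∷ 1 ─ 5 ∷ 4 ─ 6 ∷ [])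
    ∷ (2 , 0 ─ 2 ∷ 1 ─ 6 ∷ [] , 0 ─ 2 ∷ 1 ─ 6 ∷ 4 ─ 5 ∷ [])
    ∷ (20 , 0 ─ 2 ∷ 3 ─ 4 ∷ [] , 0 ─ 2 ∷ 1 ─ 6 ∷ 3 ─ 4 ∷ [])
    ∷ (3 , 0 ─ 2 ∷ 3 ─ 5 ∷ [] , 0 ─ 2 ∷ 1 ─ 6 ∷ 3 ─ 5 ∷ [])
    ∷ (36 , 0 ─ 2 ∷ 3 ─ 6 ∷ [] , 0 ─ 2 ∷ 1 ─ 4 ∷ 3 ─ 6 ∷ [])
    ∷ (1 , 0 ─ 2 ∷ 4 ─ 5 ∷ [] , 0 ─ 2 ∷ 1 ─ 3 ∷ 4 ─ 5 ∷ [])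
    ∷ (25 , 0 ─ 2 ∷ 5 ─ 6 ∷ [] , 0 ─ 2 ∷ 1 ─ 4 ∷ 5 ─ 6 ∷ [])
    ∷ (1 , 0 ─ 3 ∷ 1 ─ 2 ∷ [] , 0 ─ 3 ∷ 1 ─ 2 ∷ 4 ─ 5 ∷ [])
    ∷ (21 , 0 ─ 3 ∷ 1 ─ 4 ∷ [] , 0 ─ 3 ∷ 1 ─ 4 ∷ 2 ─ 5 ∷ [])
    ∷ (14 , 0 ─ 3 ∷ 1 ─ 5 ∷ [] , 0 ─ 3 ∷ 1 ─ 5 ∷ 4 ─ 6 ∷ [])
    ∷ (15 , 0 ─ 3 ∷ 2 ─ 4 ∷ [] , 0 ─ 3 ∷ 1 ─ 6 ∷ 2 ─ 4 ∷ [])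
    ∷ (3 , 0 ─ 3 ∷ 2 ─ 5 ∷ [] , 0 ─ 3 ∷ 2 ─ 5 ∷ 4 ─ 6 ∷ [])
    ∷ (0 , 0 ─ 3 ∷ 4 ─ 5 ∷ [] , 0 ─ 3 ∷ 2 ─ 6 ∷ 4 ─ 5 ∷ [])
    ∷ (2 , 0 ─ 3 ∷ 4 ─ 6 ∷ [] , 0 ─ 3 ∷ 1 ─ 2 ∷ 4 ─ 6 ∷ [])
    ∷ (29 , 0 ─ 3 ∷ 5 ─ 6 ∷ [] , 0 ─ 3 ∷ 1 ─ 2 ∷ 5 ─ 6 ∷ [])
    ∷ (7 , 0 ─ 4 ∷ 1 ─ 2 ∷ [] , 0 ─ 4 ∷ 1 ─ 2 ∷ 3 ─ 5 ∷ [])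
    ∷ (15 , 0 ─ 4 ∷ 1 ─ 3 ∷ [] , 0 ─ 4 ∷ 1 ─ 3 ∷ 2 ─ 6 ∷ [])
    ∷ (5 , 0 ─ 4 ∷ 1 ─ 6 ∷ [] , 0 ─ 4 ∷ 1 ─ 6 ∷ 2 ─ 5 ∷ [])
    ∷ (6 , 0 ─ 4 ∷ 2 ─ 3 ∷ [] , 0 ─ 4 ∷ 1 ─ 6 ∷ 2 ─ 3 ∷ [])
    ∷ (14 , 0 ─ 4 ∷ 2 ─ 6 ∷ [] , 0 ─ 4 ∷ 2 ─ 6 ∷ 3 ─ 5 ∷ [])
    ∷ (6 , 0 ─ 4 ∷ 3 ─ 5 ∷ [] , 0 ─ 4 ∷ 1 ─ 6 ∷ 3 ─ 5 ∷ [])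
    ∷ (8 , 0 ─ 4 ∷ 3 ─ 6 ∷ [] , 0 ─ 4 ∷ 1 ─ 2 ∷ 3 ─ 6 ∷ [])
    ∷ (27 , 0 ─ 4 ∷ 5 ─ 6 ∷ [] , 0 ─ 4 ∷ 1 ─ 3 ∷ 5 ─ 6 ∷ [])
    ∷ (33 , 0 ─ 5 ∷ 1 ─ 2 ∷ [] , 0 ─ 5 ∷ 1 ─ 2 ∷ 4 ─ 6 ∷ [])
    ∷ (31 , 0 ─ 5 ∷ 1 ─ 3 ∷ [] , 0 ─ 5 ∷ 1 ─ 3 ∷ 2 ─ 6 ∷ [])
    ∷ (29 , 0 ─ 5 ∷ 1 ─ 4 ∷ [] , 0 ─ 5 ∷ 1 ─ 4 ∷ 2 ─ 3 ∷ [])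
    ∷ (33 , 0 ─ 5 ∷ 1 ─ 6 ∷ [] , 0 ─ 5 ∷ 1 ─ 6 ∷ 2 ─ 4 ∷ [])
    ∷ (32 , 0 ─ 5 ∷ 2 ─ 4 ∷ [] , 0 ─ 5 ∷ 1 ─ 3 ∷ 2 ─ 4 ∷ [])
    ∷ (30 , 0 ─ 5 ∷ 2 ─ 6 ∷ [] , 0 ─ 5 ∷ 1 ─ 4 ∷ 2 ─ 6 ∷ [])
    ∷ (31 , 0 ─ 5 ∷ 3 ─ 4 ∷ [] , 0 ─ 5 ∷ 2 ─ 6 ∷ 3 ─ 4 ∷ [])
    ∷ (34 , 0 ─ 5 ∷ 3 ─ 6 ∷ [] , 0 ─ 5 ∷ 1 ─ 2 ∷ 3 ─ 6 ∷ [])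
    ∷ (32 , 0 ─ 5 ∷ 4 ─ 6 ∷ [] , 0 ─ 5 ∷ 1 ─ 3 ∷ 4 ─ 6 ∷ [])
    ∷ (25 , 0 ─ 6 ∷ 1 ─ 2 ∷ [] , 0 ─ 6 ∷ 1 ─ 2 ∷ 3 ─ 5 ∷ [])
    ∷ (32 , 0 ─ 6 ∷ 1 ─ 3 ∷ [] , 0 ─ 6 ∷ 1 ─ 3 ∷ 2 ─ 4 ∷ [])
    ∷ (27 , 0 ─ 6 ∷ 2 ─ 3 ∷ [] , 0 ─ 6 ∷ 2 ─ 3 ∷ 4 ─ 5 ∷ [])
    ∷ (17 , 0 ─ 6 ∷ 2 ─ 4 ∷ [] , 0 ─ 6 ∷ 1 ─ 5 ∷ 2 ─ 4 ∷ [])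
    ∷ (19 , 0 ─ 6 ∷ 2 ─ 5 ∷ [] , 0 ─ 6 ∷ 2 ─ 5 ∷ 3 ─ 4 ∷ [])
    ∷ (24 , 0 ─ 6 ∷ 3 ─ 5 ∷ [] , 0 ─ 6 ∷ 1 ─ 4 ∷ 3 ─ 5 ∷ [])
    ∷ (26 , 0 ─ 6 ∷ 4 ─ 5 ∷ [] , 0 ─ 6 ∷ 1 ─ 2 ∷ 4 ─ 5 ∷ [])
    ∷ (26 , 1 ─ 2 ∷ 3 ─ 4 ∷ [] , 0 ─ 6 ∷ 1 ─ 2 ∷ 3 ─ 4 ∷ [])
    ∷ (5 , 1 ─ 2 ∷ 3 ─ 5 ∷ [] , 1 ─ 2 ∷ 3 ─ 5 ∷ 4 ─ 6 ∷ [])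
    ∷ (0 , 1 ─ 2 ∷ 4 ─ 5 ∷ [] , 1 ─ 2 ∷ 3 ─ 6 ∷ 4 ─ 5 ∷ [])
    ∷ (28 , 1 ─ 2 ∷ 5 ─ 6 ∷ [] , 0 ─ 4 ∷ 1 ─ 2 ∷ 5 ─ 6 ∷ [])
    ∷ (31 , 1 ─ 3 ∷ 2 ─ 4 ∷ [] , 1 ─ 3 ∷ 2 ─ 4 ∷ 5 ─ 6 ∷ [])
    ∷ (33 , 1 ─ 3 ∷ 2 ─ 5 ∷ [] , 0 ─ 6 ∷ 1 ─ 3 ∷ 2 ─ 5 ∷ [])
    ∷ (0 , 1 ─ 3 ∷ 4 ─ 5 ∷ [] , 1 ─ 3 ∷ 2 ─ 6 ∷ 4 ─ 5 ∷ [])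
    ∷ (26 , 1 ─ 3 ∷ 5 ─ 6 ∷ [] , 0 ─ 2 ∷ 1 ─ 3 ∷ 5 ─ 6 ∷ [])
    ∷ (28 , 1 ─ 4 ∷ 2 ─ 3 ∷ [] , 0 ─ 6 ∷ 1 ─ 4 ∷ 2 ─ 3 ∷ [])
    ∷ (20 , 1 ─ 4 ∷ 2 ─ 5 ∷ [] , 0 ─ 6 ∷ 1 ─ 4 ∷ 2 ─ 5 ∷ [])
    ∷ (22 , 1 ─ 4 ∷ 2 ─ 6 ∷ [] , 0 ─ 3 ∷ 1 ─ 4 ∷ 2 ─ 6 ∷ [])
    ∷ (23 , 1 ─ 4 ∷ 3 ─ 5 ∷ [] , 1 ─ 4 ∷ 2 ─ 6 ∷ 3 ─ 5 ∷ [])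
    ∷ (35 , 1 ─ 4 ∷ 3 ─ 6 ∷ [] , 0 ─ 5 ∷ 1 ─ 4 ∷ 3 ─ 6 ∷ [])
    ∷ (7 , 1 ─ 5 ∷ 2 ─ 3 ∷ [] , 0 ─ 4 ∷ 1 ─ 5 ∷ 2 ─ 3 ∷ [])
    ∷ (16 , 1 ─ 5 ∷ 2 ─ 4 ∷ [] , 0 ─ 3 ∷ 1 ─ 5 ∷ 2 ─ 4 ∷ [])
    ∷ (15 , 1 ─ 5 ∷ 2 ─ 6 ∷ [] , 0 ─ 4 ∷ 1 ─ 5 ∷ 2 ─ 6 ∷ [])
    ∷ (0 , 1 ─ 5 ∷ 3 ─ 4 ∷ [] , 0 ─ 6 ∷ 1 ─ 5 ∷ 3 ─ 4 ∷ [])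
    ∷ (9 , 1 ─ 5 ∷ 3 ─ 6 ∷ [] , 0 ─ 4 ∷ 1 ─ 5 ∷ 3 ─ 6 ∷ [])
    ∷ (13 , 1 ─ 5 ∷ 4 ─ 6 ∷ [] , 1 ─ 5 ∷ 2 ─ 3 ∷ 4 ─ 6 ∷ [])
    ∷ (14 , 1 ─ 6 ∷ 2 ─ 4 ∷ [] , 1 ─ 6 ∷ 2 ─ 4 ∷ 3 ─ 5 ∷ [])
    ∷ (4 , 1 ─ 6 ∷ 2 ─ 5 ∷ [] , 0 ─ 3 ∷ 1 ─ 6 ∷ 2 ─ 5 ∷ [])
    ∷ (19 , 1 ─ 6 ∷ 3 ─ 4 ∷ [] , 1 ─ 6 ∷ 2 ─ 5 ∷ 3 ─ 4 ∷ [])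
    ∷ (1 , 1 ─ 6 ∷ 4 ─ 5 ∷ [] , 0 ─ 3 ∷ 1 ─ 6 ∷ 4 ─ 5 ∷ [])
    ∷ (2 , 2 ─ 3 ∷ 4 ─ 5 ∷ [] , 1 ─ 6 ∷ 2 ─ 3 ∷ 4 ─ 5 ∷ [])
    ∷ (12 , 2 ─ 3 ∷ 4 ─ 6 ∷ [] , 0 ─ 1 ∷ 2 ─ 3 ∷ 4 ─ 6 ∷ [])
    ∷ (29 , 2 ─ 3 ∷ 5 ─ 6 ∷ [] , 1 ─ 4 ∷ 2 ─ 3 ∷ 5 ─ 6 ∷ [])
    ∷ (13 , 2 ─ 4 ∷ 3 ─ 5 ∷ [] , 0 ─ 1 ∷ 2 ─ 4 ∷ 3 ─ 5 ∷ [])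
    ∷ (30 , 2 ─ 4 ∷ 5 ─ 6 ∷ [] , 0 ─ 3 ∷ 2 ─ 4 ∷ 5 ─ 6 ∷ [])
    ∷ (18 , 2 ─ 5 ∷ 3 ─ 4 ∷ [] , 0 ─ 1 ∷ 2 ─ 5 ∷ 3 ─ 4 ∷ [])
    ∷ (9 , 2 ─ 5 ∷ 3 ─ 6 ∷ [] , 0 ─ 4 ∷ 2 ─ 5 ∷ 3 ─ 6 ∷ [])
    ∷ (16 , 2 ─ 6 ∷ 3 ─ 4 ∷ [] , 1 ─ 5 ∷ 2 ─ 6 ∷ 3 ─ 4 ∷ [])
    ∷ (13 , 2 ─ 6 ∷ 3 ─ 5 ∷ [] , 0 ─ 1 ∷ 2 ─ 6 ∷ 3 ─ 5 ∷ [])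
    ∷ (29 , 3 ─ 4 ∷ 5 ─ 6 ∷ [] , 1 ─ 2 ∷ 3 ─ 4 ∷ 5 ─ 6 ∷ [])
    ∷ (4 , 3 ─ 5 ∷ 4 ─ 6 ∷ [] , 0 ─ 2 ∷ 3 ─ 5 ∷ 4 ─ 6 ∷ [])
    ∷ []

pairs : List (Code × Code)
pairs = map proj₂ rankedPairs

V : VF 7
V = map (Σ.map ⟦_⟧ ⟦_⟧) pairs

CofacePair : Code × Code → Set
CofacePair (a , b) = a ∈ simplices × b ∈ simplices × All (_∈ b) a × length b ≡ suc (length a)

pairOf : Code → Maybe (Code × Code)
pairOf c = firstSuchThat (λ p → (c ≟ᶜ proj₁ p) ⊎-dec (c ≟ᶜ proj₂ p)) pairs

rank : Code → ℕ
rank c = maybe proj₁ 0 (firstSuchThat (λ r → c ≟ᶜ proj₁ (proj₂ r)) rankedPairs)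

RankDecreases : Code × Code → Code → Set
RankDecreases (a , b) γ = All (_∈ b) γ → length b ≡ suc (length γ) → γ ≢ a → rank γ ℕ.< rank a

opaque
  unfolding rankedPairs matchingsIn edges

  ranks-decrease : All (λ p → All (RankDecreases p) (map proj₁ pairs)) pairs
  ranks-decrease = from-yes (All.all? (λ p → All.all? (λ γ → All.all? (_∈? proj₂ p) γ
    →-dec length (proj₂ p) ℕ.≟ suc (length γ) →-dec ¬? (γ ≟ᶜ proj₁ p)
    →-dec rank γ ℕ.<? rank (proj₁ p)) (map proj₁ pairs)) pairs)

  pairs-located : All (λ p → pairOf (proj₁ p) ≡ just p × pairOf (proj₂ p) ≡ just p) pairs
  pairs-located = from-yes (All.all? (λ p → pairOf (proj₁ p) ≟ₘ just p ×-dec pairOf (proj₂ p) ≟ₘ just p) pairs)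
    where
    _≟ₘ_ : DecidableEquality (Maybe (Code × Code))
    _≟ₘ_ = MaybeP.≡-dec (Σ.≡-dec _≟ᶜ_ _≟ᶜ_)

  pairs-cofaces : All CofacePair pairs
  pairs-cofaces = from-yes (All.all? (λ p → proj₁ p ∈ᶜ? simplices ×-dec proj₂ p ∈ᶜ? simplices
    ×-dec All.all? (_∈? proj₂ p) (proj₁ p) ×-dec length (proj₂ p) ℕ.≟ suc (length (proj₁ p))) pairs)

module _ {a b : Code} (ab∈pairs : (a , b) ∈ pairs) where

  private
    coface : CofacePair (a , b)
    coface = All.lookup pairs-cofaces ab∈pairs

  pair-facet : IsFacet ⟦ a ⟧ ⟦ b ⟧
  pair-facet with coface
  ... | a∈ , b∈ , a⊆b , length≡ = facet-⟦⟧ {⟦ b ⟧} (simplex-matching b∈) (All.map ∈⇒∋ a⊆b) (simplex-unique a∈)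
    (proj₂ (proj₂ (simplex-wellFormed a∈))) (trans (simplex-card b∈) length≡)

  component-located : ∀ {σ} → InPair σ (⟦ a ⟧ , ⟦ b ⟧) →
                      ∃[ c ] c ∈ simplices × σ ≡ ⟦ c ⟧ × (c ≡ a ⊎ c ≡ b)
  component-located (inj₁ σ≡) = a , proj₁ coface , σ≡ , inj₁ refl
  component-located (inj₂ σ≡) = b , proj₁ (proj₂ coface) , σ≡ , inj₂ refl

  pairOf-component : ∀ {c} → c ≡ a ⊎ c ≡ b → pairOf c ≡ just (a , b)
  pairOf-component (inj₁ refl) = proj₁ (All.lookup pairs-located ab∈pairs)
  pairOf-component (inj₂ refl) = proj₂ (All.lookup pairs-located ab∈pairs)

V-facets : All (λ p → IsFacet (proj₁ p) (proj₂ p)) V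
V-facets = AllP.map⁺ {xs = pairs} {f = Σ.map ⟦_⟧ ⟦_⟧} (All.tabulate pair-facet)

V-pairs-disjoint : ∀ (σ : EdgeSet 7) p q → p ∈ V → q ∈ V → InPair σ p → InPair σ q → p ≡ q
V-pairs-disjoint σ p q p∈V q∈V σ∈p σ∈q
  with ∈-map⁻ (Σ.map ⟦_⟧ ⟦_⟧) p∈V | ∈-map⁻ (Σ.map ⟦_⟧ ⟦_⟧) q∈V
... | P , P∈ , refl | Q , Q∈ , refl
  with component-located P∈ σ∈p | component-located Q∈ σ∈q
...   | c , c∈ , σ≡⟦c⟧ , c∈P | d , d∈ , σ≡⟦d⟧ , d∈Q
  with refl ← ⟦⟧-injective c∈ d∈ (trans (sym σ≡⟦c⟧) σ≡⟦d⟧)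
  with refl ← trans (sym (pairOf-component P∈ c∈P)) (pairOf-component Q∈ d∈Q) = refl

V-acyclic : ∀ σ → ¬ TransClosure (VStep V) σ σ
V-acyclic = decreasing⇒acyclic (rank ∘ code) rank-decreases
  where
  rank-decreases : ∀ {σ τ υ} → VStep V σ τ → VStep V τ υ → rank (code τ) ℕ.< rank (code σ)
  rank-decreases (_ , στ′∈V , τ-facet , τ≢σ) (_ , τυ′∈V , _)
    with ∈-map⁻ (Σ.map ⟦_⟧ ⟦_⟧) στ′∈V | ∈-map⁻ (Σ.map ⟦_⟧ ⟦_⟧) τυ′∈V
  ... | (a , b) , ab∈ , refl | (a′ , b′) , a′b′∈ , refl
    with All.lookup pairs-cofaces ab∈ | All.lookup pairs-cofaces a′b′∈
  ...   | a∈ , b∈ , _ | a′∈ , _ = subst₂ ℕ._<_ (cong rank (sym (code-⟦⟧ a′∈))) (cong rank (sym (code-⟦⟧ a∈)))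
    (All.lookup (All.lookup ranks-decrease ab∈) (∈-map⁺ proj₁ a′b′∈)
      (All.tabulate (⟦⟧-mono⁻ (proj₁ (proj₂ (proj₂ τ-facet)))))
      (trans (sym (simplex-card b∈)) (trans (proj₂ (proj₂ (proj₂ τ-facet))) (cong suc (simplex-card a′∈))))
      (τ≢σ ∘ cong ⟦_⟧))

V-gradient : IsGradient V
V-gradient = V-facets , V-pairs-disjoint , V-acyclic

opaque
  unfolding matchingsIn edges

  simplices-unique : Unique simplices
  simplices-unique = from-yes (uniqueᶜ? simplices)

hasCard-filter : ∀ {P : EdgeSet 7 → Set} {Q : Code → Set} (Q? : ∀ c → Dec (Q c)) →
  (∀ {σ} → P σ → IsMatching σ) → (∀ {c} → c ∈ simplices → P ⟦ c ⟧ ⇔ Q c) →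
  HasCard P (length (filter Q? simplices))
hasCard-filter {P} Q? P⇒matching P⇔Q = map ⟦_⟧ chosen , unique , (λ σ → mk⇔ to from) , List.length-map ⟦_⟧ chosen
  where
  chosen : List Code
  chosen = filter Q? simplices
  chosen⊆simplices : ∀ {c} → c ∈ chosen → c ∈ simplices
  chosen⊆simplices = proj₁ ∘ ∈-filter⁻ Q? {xs = simplices}
  unique : Unique (map ⟦_⟧ chosen)
  unique = Unique.map⁻ (subst Unique (sym code∘⟦⟧) (Unique.filter⁺ Q? simplices-unique))
    where
    code∘⟦⟧ : map code (map ⟦_⟧ chosen) ≡ chosen
    code∘⟦⟧ = trans (sym (List.map-∘ {g = code} {f = ⟦_⟧} chosen))
      (List.map-id-local (All.tabulate (code-⟦⟧ ∘ chosen⊆simplices)))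
  to : ∀ {σ} → σ ∈ map ⟦_⟧ chosen → P σ
  to σ∈ with ∈-map⁻ ⟦_⟧ {xs = chosen} σ∈
  ... | c , c∈ , refl = Equivalence.from (P⇔Q (chosen⊆simplices c∈)) (proj₂ (∈-filter⁻ Q? {xs = simplices} c∈))
  from : ∀ {σ} → P σ → σ ∈ map ⟦_⟧ chosen
  from {σ} Pσ = subst (_∈ map ⟦_⟧ chosen) (⟦code⟧ {σ} matching)
    (∈-map⁺ ⟦_⟧ (∈-filter⁺ Q? (code∈simplices {σ} matching)
      (Equivalence.to (P⇔Q (code∈simplices {σ} matching)) (subst P (sym (⟦code⟧ {σ} matching)) Pσ))))
    where
    matching : IsMatching σ
    matching = P⇒matching Pσ

criticalCodes : VF 7 → List Code
criticalCodes W = filter (λ c → ¬? (paired? W ⟦ c ⟧)) simplices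

critical-hasCard : ∀ W → HasCard (IsCritical W) (length (criticalCodes W))
critical-hasCard W = hasCard-filter (λ c → ¬? (paired? W ⟦ c ⟧)) proj₁ λ c∈ → mk⇔ proj₂ (simplex-matching c∈ ,_)

PairedCode : Code → Set
PairedCode c = Any (λ p → c ≡ proj₁ p ⊎ c ≡ proj₂ p) pairs

pairedCode? : ∀ c → Dec (PairedCode c)
pairedCode? c = Any.any? (λ p → (c ≟ᶜ proj₁ p) ⊎-dec (c ≟ᶜ proj₂ p)) pairs

paired-V⇔ : ∀ {c} → c ∈ simplices → Paired V ⟦ c ⟧ ⇔ PairedCode c
paired-V⇔ {c} c∈ = mk⇔ to from
  where
  to : Paired V ⟦ c ⟧ → PairedCode c
  to paired with find paired
  ... | p , p∈V , ⟦c⟧∈p with ∈-map⁻ (Σ.map ⟦_⟧ ⟦_⟧) {xs = pairs} p∈V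
  ...   | P , P∈ , refl with component-located P∈ ⟦c⟧∈p
  ...     | d , d∈ , ⟦c⟧≡⟦d⟧ , d∈P with refl ← ⟦⟧-injective c∈ d∈ ⟦c⟧≡⟦d⟧ = lose P∈ d∈P
  from : PairedCode c → Paired V ⟦ c ⟧
  from paired with find paired
  ... | P , P∈ , c∈P = lose (∈-map⁺ (Σ.map ⟦_⟧ ⟦_⟧) P∈) (Sum.map (cong ⟦_⟧) (cong ⟦_⟧) c∈P)

criticalOfDim? : ∀ d c → Dec (length c ≡ suc d × ¬ PairedCode c)
criticalOfDim? d c = hasLength? (suc d) c ×-dec ¬? (pairedCode? c)

V-criticalDim-hasCard : ∀ d → HasCard (IsCriticalDim V d) (length (filter (criticalOfDim? d) simplices))
V-criticalDim-hasCard d =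
  hasCard-filter {P = IsCriticalDim V d} (criticalOfDim? d) (proj₁ ∘ proj₁) (λ c∈ → mk⇔ (to c∈) (from c∈))
  where
  to : ∀ {c} → c ∈ simplices → IsCriticalDim V d ⟦ c ⟧ → length c ≡ suc d × ¬ PairedCode c
  to c∈ ((_ , card≡) , unpaired) = trans (sym (simplex-card c∈)) card≡ , unpaired ∘ Equivalence.from (paired-V⇔ c∈)
  from : ∀ {c} → c ∈ simplices → length c ≡ suc d × ¬ PairedCode c → IsCriticalDim V d ⟦ c ⟧
  from c∈ (length≡ , unpaired) =
    (simplex-matching c∈ , trans (simplex-card c∈) length≡) , unpaired ∘ Equivalence.to (paired-V⇔ c∈)

V-critical-hasCard : HasCard (IsCritical V) (length (filter (¬? ∘ pairedCode?) simplices))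
V-critical-hasCard = hasCard-filter {P = IsCritical V} (¬? ∘ pairedCode?) proj₁ (λ c∈ → mk⇔ (to c∈) (from c∈))
  where
  to : ∀ {c} → c ∈ simplices → IsCritical V ⟦ c ⟧ → ¬ PairedCode c
  to c∈ (_ , unpaired) = unpaired ∘ Equivalence.from (paired-V⇔ c∈)
  from : ∀ {c} → c ∈ simplices → ¬ PairedCode c → IsCritical V ⟦ c ⟧
  from c∈ unpaired = simplex-matching c∈ , unpaired ∘ Equivalence.to (paired-V⇔ c∈)

opaque
  unfolding rankedPairs matchingsIn edges

  V-critical-counts : length (filter (criticalOfDim? 2) simplices) ≡ 21 × length (filter (criticalOfDim? 1) simplices) ≡ 1
    × length (filter (criticalOfDim? 0) simplices) ≡ 1 × length (filter (¬? ∘ pairedCode?) simplices) ≡ 23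
  V-critical-counts = from-yes (length (filter (criticalOfDim? 2) simplices) ℕ.≟ 21
    ×-dec length (filter (criticalOfDim? 1) simplices) ℕ.≟ 1 ×-dec length (filter (criticalOfDim? 0) simplices) ℕ.≟ 1
    ×-dec length (filter (¬? ∘ pairedCode?) simplices) ℕ.≟ 23)

-- Cocycles and critical edges

opaque
  unfolding matchingsIn edges

  square-edges : (0 ─ 1 ∷ 2 ─ 3 ∷ []) ∈ simplicesOfDim 1 × (0 ─ 4 ∷ 2 ─ 3 ∷ []) ∈ simplicesOfDim 1
    × (0 ─ 4 ∷ 2 ─ 5 ∷ []) ∈ simplicesOfDim 1 × (0 ─ 1 ∷ 2 ─ 5 ∷ []) ∈ simplicesOfDim 1
  square-edges = from-yes ((0 ─ 1 ∷ 2 ─ 3 ∷ []) ∈ᶜ? simplicesOfDim 1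
    ×-dec (0 ─ 4 ∷ 2 ─ 3 ∷ []) ∈ᶜ? simplicesOfDim 1
    ×-dec (0 ─ 4 ∷ 2 ─ 5 ∷ []) ∈ᶜ? simplicesOfDim 1
    ×-dec (0 ─ 1 ∷ 2 ─ 5 ∷ []) ∈ᶜ? simplicesOfDim 1)

module _ {g ℓ} (G : AbelianGroup g ℓ) where
  open AbelianGroup G using (Carrier; _≈_; _∙_; ε; _⁻¹; _-_; ⁻¹-cong; reflexive)
    renaming (trans to ≈-trans)
  open import Algebra.Properties.AbelianGroup G using (⁻¹-anti-homo‿-)

  record Cocycle : Set (g ⊔ ℓ) where
    field
      φ : Edge → Edge → Carrier
      alternating : ∀ {σ : EdgeSet 7} {a b} → IsSimplexDim 1 σ → σ ∋ a → σ ∋ b → a ≢ b → φ b a ≈ φ a b ⁻¹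
      closed : ∀ {τ : EdgeSet 7} {a b c} → IsSimplexDim 2 τ → τ ∋ a → τ ∋ b → τ ∋ c →
               a ≢ b → b ≢ c → c ≢ a → φ a b ∙ φ b c ∙ φ c a ≈ ε

  IsCoboundary : Cocycle → Set (g ⊔ ℓ)
  IsCoboundary Φ = Σ[ ψ ∈ (Edge → Carrier) ]
    ∀ {σ : EdgeSet 7} {a b} → IsSimplexDim 1 σ → σ ∋ a → σ ∋ b → a ≢ b → Cocycle.φ Φ a b ≈ ψ b - ψ a

  -- If no edge is critical, ψ x = ψ w − φ x w whenever the vertex x is paired with the edge {x, w};
  -- this recursion descends along V-paths.  Every edge is then exact by induction along V-paths: an
  -- edge paired with a vertex by the definition of ψ, an edge paired with a triangle by closedness,
  -- since the two other faces of the triangle follow it on a V-path.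
  module Potential {W : VF 7} (gradient : IsGradient W) (edges-paired : ∀ {σ} → IsSimplexDim 1 σ → Paired W σ)
                   (Φ : Cocycle) where
    open Cocycle Φ

    Step : Edge → Edge → Set
    Step x y = VStep W ⟦ [ x ] ⟧ ⟦ [ y ] ⟧

    step-wellFounded : WellFounded (flip Step)
    step-wellFounded = acyclic⇒wellFounded edges into-edges λ x cycle → proj₂ (proj₂ gradient) ⟦ [ x ] ⟧ (lift cycle)
      where
      into-edges : ∀ {x y} → Step x y → y ∈ edges
      into-edges {y = y} (_ , _ , y-facet , _) = proper⇒∈edges (∋-proper {⟦ [ y ] ⟧} (proj₁ y-facet) (∈⇒∋ (here refl)))
      lift : ∀ {x y} → TransClosure Step x y → TransClosure (VStep W) ⟦ [ x ] ⟧ ⟦ [ y ] ⟧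
      lift Plus.[ r ] = Plus.[ r ]
      lift (r ∷ rs) = r ∷ lift rs

    module _ {x β} (xβ∈W : (⟦ [ x ] ⟧ , β) ∈ W) where

      private
        facet : IsFacet ⟦ [ x ] ⟧ β
        facet = All.lookup (proj₁ gradient) xβ∈W

      upper-edge : IsSimplexDim 1 β
      upper-edge = coface⇒dim {⟦ [ x ] ⟧} {β} facet
        (card-⟦⟧ (∋⇒wellFormed {⟦ [ x ] ⟧} (proj₁ facet) (∈⇒∋ (here refl) ∷ []) (s≤s z≤n)) ([] ∷ []))

      upper∋x : β ∋ x
      upper∋x = proj₁ (proj₂ (proj₂ facet)) _ _ (∈⇒∋ (here refl))

      private
        other-end : ∃[ w ] β ∋ w × w ∉ [ x ]
        other-end = ∃-outside {β} (proj₁ upper-edge) [ x ] (subst (1 ℕ.<_) (sym (proj₂ upper-edge)) (s≤s (s≤s z≤n)))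

      upper-end : Edge
      upper-end = proj₁ other-end

      upper∋end : β ∋ upper-end
      upper∋end = proj₁ (proj₂ other-end)

      end≢x : upper-end ≢ x
      end≢x = proj₂ (proj₂ other-end) ∘ here

      upper-step : Step x upper-end
      upper-step = β , xβ∈W ,
        facet-⟦⟧ {β} (proj₁ upper-edge) (upper∋end ∷ []) ([] ∷ []) (s≤s z≤n) (proj₂ upper-edge) ,
        λ ⟦end⟧≡⟦x⟧ → proj₂ (proj₂ other-end) (∋⇒∈ (subst (_∋ upper-end) ⟦end⟧≡⟦x⟧ (∈⇒∋ (here refl))))

    Up : Edge → Set
    Up x = ∃[ β ] (⟦ [ x ] ⟧ , β) ∈ W

    up? : ∀ x → Dec (Up x)
    up? x = map′ from-any (λ (_ , xβ∈W) → lose xβ∈W refl) (Any.any? (λ p → ⟦ [ x ] ⟧ ≟ˢ proj₁ p) W)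
      where
      from-any : Any (λ p → ⟦ [ x ] ⟧ ≡ proj₁ p) W → Up x
      from-any any with find any
      ... | (α , β) , αβ∈W , refl = β , αβ∈W

    descendWith : ∀ x → Dec (Up x) → (∀ {y} → Step x y → Carrier) → Carrier
    descendWith x (no _) rec = ε
    descendWith x (yes (_ , xβ∈W)) rec = rec (upper-step xβ∈W) - φ x (upper-end xβ∈W)

    descend : ∀ x → (∀ {y} → Step x y → Carrier) → Carrier
    descend x = descendWith x (up? x)

    descend-ext : ∀ x {rec rec′ : ∀ {y} → Step x y → Carrier} → (∀ {y} (r : Step x y) → rec r ≡ rec′ r) →
      descend x rec ≡ descend x rec′
    descend-ext x = ext (up? x)
      where
      ext : ∀ (up : Dec (Up x)) {rec rec′ : ∀ {y} → Step x y → Carrier} → (∀ {y} (r : Step x y) → rec r ≡ rec′ r) →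
        descendWith x up rec ≡ descendWith x up rec′
      ext (no _) _ = refl
      ext (yes (_ , xβ∈W)) rec≡rec′ = cong (_- φ x (upper-end xβ∈W)) (rec≡rec′ (upper-step xβ∈W))

    open FixPoint step-wellFounded (λ _ → Carrier) descend descend-ext using (unfold-wfRec)

    ψ : Edge → Carrier
    ψ = WF.All.wfRec step-wellFounded g (λ _ → Carrier) descend

    descend-upward : ∀ {x} {β : EdgeSet 7} → (⟦ [ x ] ⟧ , β) ∈ W → (rec : ∀ {y} → Step x y → Carrier) → ∀ {v} →
      (∀ {β′} (xβ′∈W : (⟦ [ x ] ⟧ , β′) ∈ W) → rec (upper-step xβ′∈W) - φ x (upper-end xβ′∈W) ≡ v) →
      descend x rec ≡ v
    descend-upward {x} {β} xβ∈W rec {v} value = upward (up? x)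
      where
      upward : (up : Dec (Up x)) → descendWith x up rec ≡ v
      upward (no ¬up) = contradiction (β , xβ∈W) ¬up
      upward (yes (_ , xβ′∈W)) = value xβ′∈W

    ψ-step : ∀ {x} {β : EdgeSet 7} {w} → (⟦ [ x ] ⟧ , β) ∈ W → β ∋ w → w ≢ x → ψ x ≡ ψ w - φ x w
    ψ-step {x} {β} {w} xβ∈W β∋w w≢x = trans unfold-wfRec (descend-upward xβ∈W (λ {y} _ → ψ y) λ xβ′∈W →
      cong (λ v → ψ v - φ x v) (same-end xβ′∈W))
      where
      same-end : ∀ {β′} (xβ′∈W : (⟦ [ x ] ⟧ , β′) ∈ W) → upper-end xβ′∈W ≡ w
      same-end {β′} xβ′∈W = edge-has-two-ends {β} (upper-edge xβ∈W) (upper∋x xβ∈W) β∋w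
        (subst (_∋ upper-end xβ′∈W) β′≡β (upper∋end xβ′∈W)) w≢x (end≢x xβ′∈W)
        where
        β′≡β : β′ ≡ β
        β′≡β = cong proj₂ (pair-unique gradient {⟦ [ x ] ⟧} xβ′∈W xβ∈W (inj₁ refl) (inj₁ refl))

    Exact : Edge → Edge → Set ℓ
    Exact a b = φ a b ≈ ψ b - ψ a

    exact-upward : ∀ {x} {β : EdgeSet 7} {w} → (⟦ [ x ] ⟧ , β) ∈ W → β ∋ w → w ≢ x → Exact x w
    exact-upward {β = β} xβ∈W β∋w w≢x = x≈y-z⇒z≈y-x G (reflexive (ψ-step {β = β} xβ∈W β∋w w≢x))

    exact-flip : ∀ {σ : EdgeSet 7} {a b} → IsSimplexDim 1 σ → σ ∋ a → σ ∋ b → a ≢ b → Exact a b → Exact b a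
    exact-flip {σ} σ-edge σ∋a σ∋b a≢b exact =
      ≈-trans (alternating {σ} σ-edge σ∋a σ∋b a≢b) (≈-trans (⁻¹-cong exact) (⁻¹-anti-homo‿- _ _))

    exact-downward : ∀ {α σ : EdgeSet 7} {a b} → (α , σ) ∈ W → IsSimplexDim 1 σ →
                     σ ∋ a → σ ∋ b → a ≢ b → Exact a b
    exact-downward {α} {σ} {a} {b} ασ∈W σ-edge σ∋a σ∋b a≢b
      with vertex-shape {α} (facet⇒dim {α} {σ} (All.lookup (proj₁ gradient) ασ∈W) (proj₂ σ-edge))
    ... | x , refl with a ≟ₑ x | b ≟ₑ x
    ...   | yes refl | _        = exact-upward ασ∈W σ∋b (a≢b ∘ sym)
    ...   | no a≢x   | yes refl = exact-flip {σ} σ-edge σ∋b σ∋a (a≢b ∘ sym) (exact-upward ασ∈W σ∋a a≢x)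
    ...   | no a≢x   | no b≢x   = contradiction (edge-has-two-ends {σ} σ-edge σ∋x σ∋a σ∋b a≢x b≢x) (a≢b ∘ sym)
      where
      σ∋x : σ ∋ x
      σ∋x = proj₁ (proj₂ (proj₂ (All.lookup (proj₁ gradient) ασ∈W))) _ _ (∈⇒∋ (here refl))

    exact : ∀ {σ : EdgeSet 7} → Acc (flip (VStep W)) σ → IsSimplexDim 1 σ →
            ∀ {a b} → σ ∋ a → σ ∋ b → a ≢ b → Exact a b
    exact {σ} (acc rec) σ-edge {a} {b} σ∋a σ∋b a≢b with find (edges-paired σ-edge)
    ... | _ , ασ∈W , inj₂ refl = exact-downward ασ∈W σ-edge σ∋a σ∋b a≢b
    ... | (_ , τ) , στ∈W , inj₁ refl =
      triangle-potential G (closed {τ} τ-triangle (τ∋ σ∋a) (τ∋ σ∋b) τ∋c a≢b (c≢b ∘ sym) c≢a) exact-bc exact-ca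
      where
      facet : IsFacet σ τ
      facet = All.lookup (proj₁ gradient) στ∈W
      τ-triangle : IsSimplexDim 2 τ
      τ-triangle = coface⇒dim {σ} {τ} facet (proj₂ σ-edge)
      τ∋ : ∀ {e} → σ ∋ e → τ ∋ e
      τ∋ = proj₁ (proj₂ (proj₂ facet)) _ _
      third : ∃[ c ] τ ∋ c × c ∉ a ∷ b ∷ []
      third = ∃-outside {τ} (proj₁ τ-triangle) (a ∷ b ∷ []) (subst (2 ℕ.<_) (sym (proj₂ τ-triangle)) ℕ.≤-refl)
      c : Edge
      c = proj₁ third
      τ∋c : τ ∋ c
      τ∋c = proj₁ (proj₂ third)
      c≢a : c ≢ a
      c≢a = proj₂ (proj₂ third) ∘ here
      c≢b : c ≢ b
      c≢b = proj₂ (proj₂ third) ∘ there ∘ here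
      exact-face : ∀ {u v e} → τ ∋ u → τ ∋ v → u ≢ v → σ ∋ e → e ∉ u ∷ v ∷ [] → Exact u v
      exact-face {u} {v} {e} τ∋u τ∋v u≢v σ∋e e∉face =
        exact {⟦ u ∷ v ∷ [] ⟧} (rec (τ , στ∈W , face , λ face≡σ → e∉face (∋⇒∈ (subst (_∋ e) (sym face≡σ) σ∋e))))
          (facet⇒dim {⟦ u ∷ v ∷ [] ⟧} {τ} face (proj₂ τ-triangle))
          (∈⇒∋ (here refl)) (∈⇒∋ (there (here refl))) u≢v
        where
        face : IsFacet ⟦ u ∷ v ∷ [] ⟧ τ
        face = facet-⟦⟧ {τ} (proj₁ τ-triangle) (τ∋u ∷ τ∋v ∷ []) ((u≢v ∷ []) ∷ [] ∷ []) (s≤s z≤n)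
          (proj₂ τ-triangle)
      exact-bc : Exact b c
      exact-bc = exact-face (τ∋ σ∋b) τ∋c (c≢b ∘ sym) σ∋a
        λ { (here a≡b) → a≢b a≡b ; (there (here a≡c)) → c≢a (sym a≡c) }
      exact-ca : Exact c a
      exact-ca = exact-face τ∋c (τ∋ σ∋a) c≢a σ∋b
        λ { (here b≡c) → c≢b (sym b≡c) ; (there (here b≡a)) → a≢b (sym b≡a) }

    simplices-wellFounded : WellFounded (flip (VStep W))
    simplices-wellFounded = acyclic⇒wellFounded (map ⟦_⟧ simplices) into-simplices (proj₂ (proj₂ gradient))
      where
      into-simplices : ∀ {σ τ} → VStep W σ τ → τ ∈ map ⟦_⟧ simplices
      into-simplices {τ = τ} (_ , _ , τ-facet , _) =
        subst (_∈ map ⟦_⟧ simplices) (⟦code⟧ {τ} (proj₁ τ-facet))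
          (∈-map⁺ ⟦_⟧ (code∈simplices {τ} (proj₁ τ-facet)))

    coboundary : IsCoboundary Φ
    coboundary = ψ , λ {σ} σ-edge → exact (simplices-wellFounded σ) σ-edge

  coboundary-square : (Φ : Cocycle) → IsCoboundary Φ → let open Cocycle Φ in
    φ (0 ─ 1) (2 ─ 3) ∙ φ (2 ─ 3) (0 ─ 4) ∙ φ (0 ─ 4) (2 ─ 5) ∙ φ (2 ─ 5) (0 ─ 1) ≈ ε
  coboundary-square Φ (ψ , δψ) with square-edges
  ... | e₁ , e₂ , e₃ , e₄ = square-potential G (forward e₁) (backward e₂) (forward e₃) (backward e₄)
    where
    open Cocycle Φ
    distinct : ∀ {a b} → (a ∷ b ∷ []) ∈ simplicesOfDim 1 → a ≢ b
    distinct e with simplex-unique (∈simplicesOfDim⇒∈simplices e)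
    ... | (a≢b ∷ []) ∷ _ = a≢b
    forward : ∀ {a b} → (a ∷ b ∷ []) ∈ simplicesOfDim 1 → φ a b ≈ ψ b - ψ a
    forward {a} {b} e = δψ {⟦ a ∷ b ∷ [] ⟧} (∈simplicesOfDim⇒dim e) (∈⇒∋ (here refl)) (∈⇒∋ (there (here refl)))
      (distinct e)
    backward : ∀ {a b} → (a ∷ b ∷ []) ∈ simplicesOfDim 1 → φ b a ≈ ψ a - ψ b
    backward {a} {b} e = δψ {⟦ a ∷ b ∷ [] ⟧} (∈simplicesOfDim⇒dim e) (∈⇒∋ (there (here refl))) (∈⇒∋ (here refl))
      (≢-sym (distinct e))

  no-critical-edge⇒coboundary : ∀ {W : VF 7} → IsGradient W → (∀ {σ} → IsSimplexDim 1 σ → Paired W σ) →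
    (Φ : Cocycle) → IsCoboundary Φ
  no-critical-edge⇒coboundary gradient edges-paired Φ = Potential.coboundary gradient edges-paired Φ

-- A cocycle that is not a coboundary

ℤ₃ : Set
ℤ₃ = Fin 3

infixl 6 _+₃_
infix 8 -₃_

_+₃_ : ℤ₃ → ℤ₃ → ℤ₃
a +₃ b = (Fin.toℕ a + Fin.toℕ b) mod 3

-₃_ : ℤ₃ → ℤ₃
-₃ a = (3 ∸ Fin.toℕ a) mod 3

ℤ₃-abelianGroup : AbelianGroup 0ℓ 0ℓ
ℤ₃-abelianGroup = record
  { Carrier = ℤ₃
  ; _≈_ = _≡_
  ; _∙_ = _+₃_
  ; ε = Fin.zero
  ; _⁻¹ = -₃_
  ; isAbelianGroup = record
    { isGroup = record
      { isMonoid = record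
        { isSemigroup = record
          { isMagma = record { isEquivalence = isEquivalence ; ∙-cong = cong₂ _+₃_ }
          ; assoc = from-yes (Fin.all? λ a → Fin.all? λ b → Fin.all? λ c → (a +₃ b) +₃ c Fin.≟ a +₃ (b +₃ c))
          }
        ; identity = from-yes (Fin.all? λ a → Fin.zero +₃ a Fin.≟ a) , from-yes (Fin.all? λ a → a +₃ Fin.zero Fin.≟ a)
        }
      ; inverse = from-yes (Fin.all? λ a → (-₃ a) +₃ a Fin.≟ Fin.zero)
                , from-yes (Fin.all? λ a → a +₃ (-₃ a) Fin.≟ Fin.zero)
      ; ⁻¹-cong = cong -₃_
      }
    ; comm = from-yes (Fin.all? λ a → Fin.all? λ b → a +₃ b Fin.≟ b +₃ a)
    }
  }

-- A 1-cocycle representing a generator of H¹(M₇; ℤ₃) ≅ ℤ₃.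
cocycleTable : List (Edge × Edge × ℕ)
cocycleTable =
  (0 ─ 2 , 1 ─ 5 , 1)
  ∷ (0 ─ 2 , 1 ─ 6 , 2)
  ∷ (0 ─ 2 , 3 ─ 5 , 1)
  ∷ (0 ─ 2 , 3 ─ 6 , 2)
  ∷ (0 ─ 2 , 4 ─ 5 , 2)
  ∷ (0 ─ 2 , 4 ─ 6 , 1)
  ∷ (0 ─ 3 , 1 ─ 5 , 2)
  ∷ (0 ─ 3 , 1 ─ 6 , 1)
  ∷ (0 ─ 3 , 2 ─ 5 , 2)
  ∷ (0 ─ 3 , 2 ─ 6 , 1)
  ∷ (0 ─ 3 , 4 ─ 5 , 1)
  ∷ (0 ─ 3 , 4 ─ 6 , 2)
  ∷ (0 ─ 4 , 2 ─ 5 , 1)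
  ∷ (0 ─ 4 , 2 ─ 6 , 2)
  ∷ (0 ─ 4 , 3 ─ 5 , 2)
  ∷ (0 ─ 4 , 3 ─ 6 , 1)
  ∷ (0 ─ 5 , 1 ─ 2 , 1)
  ∷ (0 ─ 5 , 1 ─ 3 , 2)
  ∷ (0 ─ 5 , 2 ─ 4 , 2)
  ∷ (0 ─ 5 , 2 ─ 6 , 1)
  ∷ (0 ─ 5 , 3 ─ 4 , 1)
  ∷ (0 ─ 5 , 3 ─ 6 , 2)
  ∷ (0 ─ 6 , 1 ─ 2 , 2)
  ∷ (0 ─ 6 , 1 ─ 3 , 1)
  ∷ (0 ─ 6 , 2 ─ 4 , 1)
  ∷ (0 ─ 6 , 2 ─ 5 , 2)
  ∷ (0 ─ 6 , 3 ─ 4 , 2)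
  ∷ (0 ─ 6 , 3 ─ 5 , 1)
  ∷ (1 ─ 2 , 3 ─ 5 , 2)
  ∷ (1 ─ 2 , 3 ─ 6 , 1)
  ∷ (1 ─ 2 , 4 ─ 5 , 1)
  ∷ (1 ─ 2 , 4 ─ 6 , 2)
  ∷ (1 ─ 3 , 2 ─ 5 , 1)
  ∷ (1 ─ 3 , 2 ─ 6 , 2)
  ∷ (1 ─ 3 , 4 ─ 5 , 2)
  ∷ (1 ─ 3 , 4 ─ 6 , 1)
  ∷ (1 ─ 4 , 2 ─ 5 , 2)
  ∷ (1 ─ 4 , 2 ─ 6 , 1)
  ∷ (1 ─ 4 , 3 ─ 5 , 1)
  ∷ (1 ─ 4 , 3 ─ 6 , 2)
  ∷ (1 ─ 5 , 2 ─ 4 , 1)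
  ∷ (1 ─ 5 , 2 ─ 6 , 2)
  ∷ (1 ─ 5 , 3 ─ 4 , 2)
  ∷ (1 ─ 5 , 3 ─ 6 , 1)
  ∷ (1 ─ 6 , 2 ─ 4 , 2)
  ∷ (1 ─ 6 , 2 ─ 5 , 1)
  ∷ (1 ─ 6 , 3 ─ 4 , 1)
  ∷ (1 ─ 6 , 3 ─ 5 , 2)
  ∷ []

tabulated : Edge → Edge → Maybe ℕ
tabulated a b = Maybe.map (proj₂ ∘ proj₂) (firstSuchThat (λ r → (a , b) ≟ₚ (proj₁ r , proj₁ (proj₂ r))) cocycleTable)
  where
  _≟ₚ_ : DecidableEquality (Edge × Edge)
  _≟ₚ_ = Σ.≡-dec _≟ₑ_ _≟ₑ_

φ₃ : Edge → Edge → ℤ₃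
φ₃ a b with tabulated a b | tabulated b a
... | just v  | _       = v mod 3
... | nothing | just v  = -₃ (v mod 3)
... | nothing | nothing = Fin.zero

opaque
  unfolding matchingsIn edges

  φ₃-alternating-on-codes :
    All (λ e → All (λ a → All (λ b → a ≢ b → φ₃ b a ≡ -₃ φ₃ a b) e) e) (simplicesOfDim 1)
  φ₃-alternating-on-codes = from-yes (All.all? (λ e → All.all? (λ a → All.all? (λ b →
    ¬? (a ≟ₑ b) →-dec φ₃ b a Fin.≟ -₃ φ₃ a b) e) e) (simplicesOfDim 1))

  φ₃-closed-on-codes : All (λ t → All (λ a → All (λ b → All (λ c → a ≢ b → b ≢ c → c ≢ a →
    φ₃ a b +₃ φ₃ b c +₃ φ₃ c a ≡ Fin.zero) t) t) t) (simplicesOfDim 2)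
  φ₃-closed-on-codes = from-yes (All.all? (λ t → All.all? (λ a → All.all? (λ b → All.all? (λ c →
    ¬? (a ≟ₑ b) →-dec ¬? (b ≟ₑ c) →-dec ¬? (c ≟ₑ a) →-dec
    φ₃ a b +₃ φ₃ b c +₃ φ₃ c a Fin.≟ Fin.zero) t) t) t) (simplicesOfDim 2))

φ₃-cocycle : Cocycle ℤ₃-abelianGroup
φ₃-cocycle = record
  { φ = φ₃
  ; alternating = λ {σ} σ-edge σ∋a σ∋b → All.lookup (All.lookup (All.lookup φ₃-alternating-on-codes
      (code∈simplicesOfDim {σ} (proj₁ σ-edge) (proj₂ σ-edge)))
      (matching-∋⇒∈code {σ} (proj₁ σ-edge) σ∋a)) (matching-∋⇒∈code {σ} (proj₁ σ-edge) σ∋b)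
  ; closed = λ {τ} τ-triangle τ∋a τ∋b τ∋c → All.lookup (All.lookup (All.lookup (All.lookup φ₃-closed-on-codes
      (code∈simplicesOfDim {τ} (proj₁ τ-triangle) (proj₂ τ-triangle)))
      (matching-∋⇒∈code {τ} (proj₁ τ-triangle) τ∋a)) (matching-∋⇒∈code {τ} (proj₁ τ-triangle) τ∋b))
      (matching-∋⇒∈code {τ} (proj₁ τ-triangle) τ∋c)
  }

φ₃-not-coboundary : ¬ IsCoboundary ℤ₃-abelianGroup φ₃-cocycle
φ₃-not-coboundary coboundary =
  contradiction (trans (sym around-square) (coboundary-square ℤ₃-abelianGroup φ₃-cocycle coboundary)) λ ()
  where
  around-square : φ₃ (0 ─ 1) (2 ─ 3) +₃ φ₃ (2 ─ 3) (0 ─ 4) +₃ φ₃ (0 ─ 4) (2 ─ 5) +₃ φ₃ (2 ─ 5) (0 ─ 1)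
                ≡ Fin.suc Fin.zero
  around-square = refl

critical-edge : ∀ {W : VF 7} → IsGradient W → ∃[ e ] e ∈ simplicesOfDim 1 × ¬ Paired W ⟦ e ⟧
critical-edge {W} gradient with All.all? (λ e → paired? W ⟦ e ⟧) (simplicesOfDim 1)
... | yes all-paired =
  contradiction (no-critical-edge⇒coboundary ℤ₃-abelianGroup gradient edges-paired φ₃-cocycle) φ₃-not-coboundary
  where
  edges-paired : ∀ {σ} → IsSimplexDim 1 σ → Paired W σ
  edges-paired {σ} (matching , card≡) =
    subst (Paired W) (⟦code⟧ {σ} matching) (All.lookup all-paired (code∈simplicesOfDim {σ} matching card≡))
... | no ¬all-paired = find (¬All⇒Any¬ (λ e → paired? W ⟦ e ⟧) (simplicesOfDim 1) ¬all-paired)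

-- A lower bound for every gradient vector field

simplex-length : ∀ {c} → c ∈ simplices → length c ≡ 1 ⊎ length c ≡ 2 ⊎ length c ≡ 3
simplex-length c∈ with ∈-++⁻ (simplicesOfDim 0) c∈
... | inj₁ c∈₀ = inj₁ (proj₂ (∈-filter⁻ (hasLength? 1) {xs = matchings} c∈₀))
... | inj₂ c∈₁₂ with ∈-++⁻ (simplicesOfDim 1) c∈₁₂
...   | inj₁ c∈₁ = inj₂ (inj₁ (proj₂ (∈-filter⁻ (hasLength? 2) {xs = matchings} c∈₁)))
...   | inj₂ c∈₂ = inj₂ (inj₂ (proj₂ (∈-filter⁻ (hasLength? 3) {xs = matchings} c∈₂)))

matching-card-1-3 : ∀ {S} → IsMatching S → card S ≡ 1 ⊎ card S ≡ 2 ⊎ card S ≡ 3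
matching-card-1-3 {S} matching =
  subst (λ n → n ≡ 1 ⊎ n ≡ 2 ⊎ n ≡ 3) (length-code {S} matching) (simplex-length (code∈simplices {S} matching))

opaque
  unfolding matchingsIn edges

  simplices-counts : length (simplicesOfDim 1) ≡ 105 × length simplices ≡ 231
  simplices-counts = from-yes (length (simplicesOfDim 1) ℕ.≟ 105 ×-dec length simplices ℕ.≟ 231)

1-or-3-neighbour≡2 : ∀ {m n} → m ≡ 1 ⊎ m ≡ 3 → n ≡ 1 ⊎ n ≡ 2 ⊎ n ≡ 3 → n ≡ suc m ⊎ m ≡ suc n → n ≡ 2
1-or-3-neighbour≡2 _            (inj₂ (inj₁ refl)) _ = refl
1-or-3-neighbour≡2 (inj₁ refl) (inj₁ refl)        = λ { (inj₁ ()) ; (inj₂ ()) }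
1-or-3-neighbour≡2 (inj₁ refl) (inj₂ (inj₂ refl)) = λ { (inj₁ ()) ; (inj₂ ()) }
1-or-3-neighbour≡2 (inj₂ refl) (inj₁ refl)        = λ { (inj₁ ()) ; (inj₂ ()) }
1-or-3-neighbour≡2 (inj₂ refl) (inj₂ (inj₂ refl)) = λ { (inj₁ ()) ; (inj₂ ()) }

k+[y+x]≡231⇒23≤k : ∀ {k x y} → k + (y + x) ≡ 231 → x ℕ.≤ y → suc y ℕ.≤ 105 → 23 ℕ.≤ k
k+[y+x]≡231⇒23≤k {k} {x} {y} total x≤y y<105 = ℕ.+-cancelʳ-≤ 208 23 k (begin
  231          ≡⟨ sym total ⟩
  k + (y + x)  ≤⟨ ℕ.+-monoʳ-≤ k (ℕ.+-mono-≤ y≤104 (ℕ.≤-trans x≤y y≤104)) ⟩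
  k + 208      ∎)
  where
  open ℕ.≤-Reasoning
  y≤104 : y ℕ.≤ 104
  y≤104 = ℕ.≤-pred y<105

module LowerBound {W : VF 7} (gradient : IsGradient W) where

  e₀ : Code
  e₀ = proj₁ (critical-edge gradient)

  e₀∈ : e₀ ∈ simplicesOfDim 1
  e₀∈ = proj₁ (proj₂ (critical-edge gradient))

  e₀-critical : ¬ Paired W ⟦ e₀ ⟧
  e₀-critical = proj₂ (proj₂ (critical-edge gradient))

  paired?ᶜ : ∀ c → Dec (Paired W ⟦ c ⟧)
  paired?ᶜ c = paired? W ⟦ c ⟧

  pairedSimplices pairedEdges pairedNonEdges : List Code
  pairedSimplices = filter paired?ᶜ simplices
  pairedEdges = filter (hasLength? 2) pairedSimplices
  pairedNonEdges = filter (¬? ∘ hasLength? 2) pairedSimplices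

  partnerCode : Code → Code
  partnerCode c = code (partner W ⟦ c ⟧)

  module _ {c : Code} (c∈ : c ∈ pairedNonEdges) where

    private
      c∈paired : c ∈ pairedSimplices
      c∈paired = proj₁ (∈-filter⁻ (¬? ∘ hasLength? 2) {xs = pairedSimplices} c∈)
      c∈simplices : c ∈ simplices
      c∈simplices = proj₁ (∈-filter⁻ paired?ᶜ {xs = simplices} c∈paired)
      c-paired : Paired W ⟦ c ⟧
      c-paired = proj₂ (∈-filter⁻ paired?ᶜ {xs = simplices} c∈paired)
      τ : EdgeSet 7
      τ = partner W ⟦ c ⟧
      pairing : PairedWith W ⟦ c ⟧ τ
      pairing = partner-pairedWith c-paired
      τ-matching : IsMatching τ
      τ-matching = [ proj₁ ∘ proj₂ , proj₁ ]′ (pairedWith-facet gradient pairing)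
      card-c : card ⟦ c ⟧ ≡ 1 ⊎ card ⟦ c ⟧ ≡ 3
      card-c with simplex-length c∈simplices
      ... | inj₁ length≡1 = inj₁ (trans (simplex-card c∈simplices) length≡1)
      ... | inj₂ (inj₁ length≡2) =
        contradiction length≡2 (proj₂ (∈-filter⁻ (¬? ∘ hasLength? 2) {xs = pairedSimplices} c∈))
      ... | inj₂ (inj₂ length≡3) = inj₂ (trans (simplex-card c∈simplices) length≡3)
      card-τ : card τ ≡ 2
      card-τ = 1-or-3-neighbour≡2 card-c (matching-card-1-3 {τ} τ-matching)
        ([ inj₁ ∘ proj₂ ∘ proj₂ ∘ proj₂ , inj₂ ∘ proj₂ ∘ proj₂ ∘ proj₂ ]′ (pairedWith-facet gradient pairing))

    partnerCode∈pairedEdges : partnerCode c ∈ pairedEdges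
    partnerCode∈pairedEdges = ∈-filter⁺ (hasLength? 2)
      (∈-filter⁺ paired?ᶜ (code∈simplices {τ} τ-matching)
        (subst (Paired W) (sym (⟦code⟧ {τ} τ-matching)) (pairedWith⇒paired (pairedWith-sym pairing))))
      (trans (length-code {τ} τ-matching) card-τ)

    partnerCode-involutive : partnerCode (partnerCode c) ≡ c
    partnerCode-involutive = trans (cong (code ∘ partner W) (⟦code⟧ {τ} τ-matching))
      (trans (cong code (partner-involutive gradient c-paired)) (code-⟦⟧ c∈simplices))

  pairedEdge-facts : ∀ {c} → c ∈ pairedEdges → c ∈ simplices × Paired W ⟦ c ⟧ × length c ≡ 2
  pairedEdge-facts c∈ with ∈-filter⁻ (hasLength? 2) {xs = pairedSimplices} c∈
  ... | c∈paired , length≡2 with ∈-filter⁻ paired?ᶜ {xs = simplices} c∈paired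
  ...   | c∈simplices , c-paired = c∈simplices , c-paired , length≡2

  paired-unique : Unique pairedSimplices
  paired-unique = Unique.filter⁺ paired?ᶜ simplices-unique

  nonEdges≤edges : length pairedNonEdges ℕ.≤ length pairedEdges
  nonEdges≤edges = subst (ℕ._≤ length pairedEdges) (List.length-map partnerCode pairedNonEdges)
    (unique∧⊆⇒length≤ (Unique.map⁻ (subst Unique (sym twice) (Unique.filter⁺ (¬? ∘ hasLength? 2) paired-unique))) image⊆)
    where
    twice : map partnerCode (map partnerCode pairedNonEdges) ≡ pairedNonEdges
    twice = trans (sym (List.map-∘ {g = partnerCode} {f = partnerCode} pairedNonEdges))
      (List.map-id-local (All.tabulate partnerCode-involutive))
    image⊆ : map partnerCode pairedNonEdges ⊆ pairedEdges
    image⊆ d∈ with ∈-map⁻ partnerCode {xs = pairedNonEdges} d∈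
    ... | c , c∈ , refl = partnerCode∈pairedEdges c∈

  edges<105 : suc (length pairedEdges) ℕ.≤ 105
  edges<105 = subst (suc (length pairedEdges) ℕ.≤_) (proj₁ simplices-counts)
    (unique∧⊆⇒length≤ (e₀∉ ∷ Unique.filter⁺ (hasLength? 2) paired-unique) ⊆edges)
    where
    e₀∉ : All (e₀ ≢_) pairedEdges
    e₀∉ = All.tabulate λ c∈ e₀≡c →
      e₀-critical (subst (Paired W ∘ ⟦_⟧) (sym e₀≡c) (proj₁ (proj₂ (pairedEdge-facts c∈))))
    ⊆edges : e₀ ∷ pairedEdges ⊆ simplicesOfDim 1
    ⊆edges (here refl) = e₀∈
    ⊆edges {c} (there c∈) with pairedEdge-facts c∈
    ... | c∈simplices , _ , length≡2 = subst (_∈ simplicesOfDim 1) (code-⟦⟧ c∈simplices)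
      (code∈simplicesOfDim {⟦ c ⟧} (simplex-matching c∈simplices) (trans (simplex-card c∈simplices) length≡2))

  at-least-23 : 23 ℕ.≤ length (criticalCodes W)
  at-least-23 = k+[y+x]≡231⇒23≤k total nonEdges≤edges edges<105
    where
    total : length (criticalCodes W) + (length pairedEdges + length pairedNonEdges) ≡ 231
    total = trans (ℕ.+-comm (length (criticalCodes W)) _)
      (trans (cong (_+ length (criticalCodes W)) (length-filter+length-filter-¬ (hasLength? 2) pairedSimplices))
        (trans (length-filter+length-filter-¬ paired?ᶜ simplices) (proj₂ simplices-counts)))

mainTheorem1 : ∃[ V ] (IsGradient {7} V
                 × HasCard (IsCriticalDim V 2) 21
                 × HasCard (IsCriticalDim V 1) 1
                 × HasCard (IsCriticalDim V 0) 1
                 × IsOptimal V)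
mainTheorem1 with V-critical-counts
... | count₂ , count₁ , count₀ , count =
  V , V-gradient , counted 2 count₂ , counted 1 count₁ , counted 0 count₀ , V-gradient , optimal
  where
  counted : ∀ d {k} → length (filter (criticalOfDim? d) simplices) ≡ k → HasCard (IsCriticalDim V d) k
  counted d refl = V-criticalDim-hasCard d
  optimal : ∀ W k m → IsGradient W → HasCard (IsCritical V) k → HasCard (IsCritical W) m → k ℕ.≤ m
  optimal W k m gradient V-has-k W-has-m = subst₂ ℕ._≤_
    (hasCard-functional (subst (HasCard (IsCritical V)) count V-critical-hasCard) V-has-k)
    (hasCard-functional (critical-hasCard W) W-has-m)
    (LowerBound.at-least-23 gradient)
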